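{- Let $p>3$ be a prime, $\zeta_p$ a primitive $p$-th root of unity, and $K=\mathbb{Q}(\zeta_p)$ with ring of integers $\mathbb{Z}[\zeta_p]$. Let $u\in\mathbb{Z}[\zeta_p]$ be a unit which is not real, and let $A(u)\in SL_{p-1}(\mathbb{Z})$ be the matrix of the $\mathbb{Z}$-linear map $x\mapsto ux$ on $\mathbb{Z}[\zeta_p]$ with respect to an integral basis. Then $A(u)^k$ is primitive for every integer $k\not\equiv 0 \pmod p$.
   Context: For an integer matrix $A\in\operatorname{Mat}_r(\mathbb{Z})$, $A\neq I$, $\gcd(A-I)$ denotes the greatest common divisor of the entries of $A-I$ (equivalently, the largest $N\geq1$ with $A\equiv I \bmod N$). $A$ is called primitive if $\gcd(A-I)=1$. -}

module Defs where

open import Data.Nat as ℕ using (ℕ; zero; suc)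
open import Data.Nat.GCD using (gcd)
open import Data.Integer as ℤ using (ℤ; +_; -[1+_]; ∣_∣)
open import Data.Fin using (Fin; zero; suc; toℕ; fromℕ; inject₁)
open import Data.Fin.Properties using (_≟_)
open import Relation.Nullary using (yes; no)
open import Relation.Binary.PropositionalEquality using (_≡_)

-- Z[ζ_p] with p = suc n, represented in the power integral basis
-- 1, ζ, …, ζ^(n-1)  (n = p - 1), i.e. Z[x]/(1 + x + … + x^n).
Elem : ℕ → Set
Elem n = Fin n → ℤ

zeroE : ∀ {n} → Elem n
zeroE _ = + 0

_⊕_ : ∀ {n} → Elem n → Elem n → Elem n
(a ⊕ b) i = a i ℤ.+ b i

_•_ : ∀ {n} → ℤ → Elem n → Elem n
(c • a) i = c ℤ.* a i

basis : ∀ {n} → Fin n → Elem n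
basis i j with i ≟ j
... | yes _ = + 1
... | no _  = + 0

-- multiplication by ζ, using ζ^n = -(1 + ζ + … + ζ^(n-1))
mulζ : ∀ {n} → Elem n → Elem n
mulζ {zero} v = v
mulζ {suc m} v zero = ℤ.- v (fromℕ m)
mulζ {suc m} v (suc j) = v (inject₁ j) ℤ.- v (fromℕ m)

iter : ∀ {A : Set} → ℕ → (A → A) → A → A
iter zero f x = x
iter (suc k) f x = f (iter k f x)

sumE : ∀ {n m} → (Fin m → Elem n) → Elem n
sumE {m = zero} f = zeroE
sumE {m = suc m} f = f zero ⊕ sumE (λ i → f (suc i))

mul : ∀ {n} → Elem n → Elem n → Elem n
mul {n} x y = sumE (λ i → y i • iter (toℕ i) mulζ x)

oneE : ∀ {n} → Elem n
oneE {zero} = zeroE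
oneE {suc m} = basis zero

-- complex conjugation σ_{-1}: ζ ↦ ζ^{-1} = ζ^n, so ζ^i ↦ ζ^(n*i)
conj : ∀ {n} → Elem n → Elem n
conj {n} a = sumE (λ i → a i • iter (n ℕ.* toℕ i) mulζ oneE)

_≈E_ : ∀ {n} → Elem n → Elem n → Set
a ≈E b = ∀ i → a i ≡ b i

Mat : ℕ → Set
Mat n = Fin n → Fin n → ℤ

-- matrix of x ↦ u x in the basis: column i is the coordinate vector of u ζ^i
mulMat : ∀ {n} → Elem n → Mat n
mulMat u j i = mul u (basis i) j

idMat : ∀ {n} → Mat n
idMat = λ i j → basis i j

sumℤ : ∀ {m} → (Fin m → ℤ) → ℤ
sumℤ {zero} f = + 0
sumℤ {suc m} f = f zero ℤ.+ sumℤ (λ i → f (suc i))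

_⊗_ : ∀ {n} → Mat n → Mat n → Mat n
(A ⊗ B) i j = sumℤ (λ k → A i k ℤ.* B k j)

matPow : ∀ {n} → Mat n → ℕ → Mat n
matPow A zero = idMat
matPow A (suc k) = A ⊗ matPow A k

-- integer power A^k, given Ainv = A^{-1}
matZPow : ∀ {n} → Mat n → Mat n → ℤ → Mat n
matZPow A Ainv (+ k) = matPow A k
matZPow A Ainv -[1+ k ] = matPow Ainv (suc k)

gcdAll : ∀ {m} → (Fin m → ℕ) → ℕ
gcdAll {zero} f = 0
gcdAll {suc m} f = gcd (f zero) (gcdAll (λ i → f (suc i)))

gcdMinusI : ∀ {n} → Mat n → ℕ
gcdMinusI A = gcdAll (λ i → gcdAll (λ j → ∣ A i j ℤ.- idMat i j ∣))

Primitive : ∀ {n} → Mat n → Set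
Primitive A = gcdMinusI A ≡ 1

module Submission where

-- Write x̄ for complex conjugation, the automorphism ζ ↦ ζ⁻¹.  If A(u)ᵏ ≡ I mod q, the first
-- column gives uᵏ ≡ 1 mod q coordinatewise, hence ū⁻ᵏ ≡ 1 and wᵏ ≡ 1 for w = u ū⁻¹.  Since
-- w̄ w = 1, comparing traces in the basis 1, ζ, …, ζ^(p-2) gives p Σ wᵢ² - (Σ wᵢ)² = p - 1, and this
-- equation forces w = ±ζʳ.  Here r = 0 is impossible: w = 1 would make u real, and w = -1 is
-- ruled out by reducing modulo the prime above p (ζ ↦ 1).  For r ≠ 0 and p ∤ k the power
-- ±ζ^(rk) has a coordinate ±1 where 1 has a coordinate 0, so q = 1.

open import Defs
open import Data.Nat as ℕ using (ℕ; zero; suc; z≤n; s≤s; _<_; _∸_)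
import Data.Nat.Properties as ℕP
import Data.Nat.Tactic.RingSolver as ℕ-Solver
import Data.Nat.Divisibility as ND
open import Data.Nat.DivMod using (_%_; _/_; m≡m%n+[m/n]*n; m%n<n)
open import Data.Nat.GCD using (gcd[m,n]∣m; gcd[m,n]∣n)
open import Data.Nat.Primality using (Prime; euclidsLemma)
open import Data.Integer as ℤ using (ℤ; +_; +[1+_]; -[1+_]; ∣_∣; _+_; _*_; -_; _-_; 0ℤ; 1ℤ; -1ℤ)
import Data.Integer.Properties as ℤP
open import Data.Integer.Tactic.RingSolver using (solve-∀)
open import Data.Integer.Divisibility using (_∣_)
import Data.Integer.Divisibility.Signed as DS
open import Data.Fin as Fin using (Fin; zero; suc; toℕ; fromℕ; inject₁)
import Data.Fin.Properties as FinP
open import Data.Product using (Σ; _×_; _,_)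
open import Data.Sum using (_⊎_; inj₁; inj₂)
open import Data.Empty using (⊥-elim)
open import Function using (_∘_; _$_; case_of_)
open import Function.Definitions using (Injective)
open import Relation.Binary.Bundles using (Setoid)
import Relation.Binary.Reasoning.Setoid as SetoidReasoning
open import Relation.Binary.Definitions using (tri<; tri≈; tri>)
open import Relation.Binary.PropositionalEquality
open import Relation.Nullary using (¬_; yes; no)

basis-diag : ∀ {n} (i : Fin n) → basis i i ≡ 1ℤ
basis-diag i with i FinP.≟ i
... | yes _ = refl
... | no i≢i = ⊥-elim (i≢i refl)

basis-≢ : ∀ {n} {i j : Fin n} → i ≢ j → basis i j ≡ 0ℤ
basis-≢ {i = i} {j} i≢j with i FinP.≟ j
... | yes i≡j = ⊥-elim (i≢j i≡j)
... | no _ = refl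

basis-sym : ∀ {n} (i j : Fin n) → basis i j ≡ basis j i
basis-sym i j = case i FinP.≟ j of λ where
  (yes refl) → refl
  (no i≢j) → trans (basis-≢ i≢j) (sym (basis-≢ (i≢j ∘ sym)))

basis-injective : ∀ {n k} (f : Fin n → Fin k) → Injective _≡_ _≡_ f →
                  ∀ i j → basis (f i) (f j) ≡ basis i j
basis-injective f f-inj i j = case i FinP.≟ j of λ where
  (yes refl) → trans (basis-diag (f i)) (sym (basis-diag i))
  (no i≢j) → trans (basis-≢ (i≢j ∘ f-inj)) (sym (basis-≢ i≢j))

sumℤ-cong : ∀ {m} {f g : Fin m → ℤ} → (∀ i → f i ≡ g i) → sumℤ f ≡ sumℤ g
sumℤ-cong {zero} f≗g = refl
sumℤ-cong {suc m} f≗g = cong₂ _+_ (f≗g zero) (sumℤ-cong (f≗g ∘ suc))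

sumℤ-zero : ∀ m → sumℤ {m} (λ _ → 0ℤ) ≡ 0ℤ
sumℤ-zero zero = refl
sumℤ-zero (suc m) = trans (ℤP.+-identityˡ _) (sumℤ-zero m)

sumℤ-const : ∀ m c → sumℤ {m} (λ _ → c) ≡ + m * c
sumℤ-const zero c = sym (ℤP.*-zeroˡ c)
sumℤ-const (suc m) c = begin
  c + sumℤ {m} (λ _ → c)   ≡⟨ cong (λ t → c + t) (sumℤ-const m c) ⟩
  c + + m * c              ≡⟨ sym (ℤP.suc-* (+ m) c) ⟩
  + suc m * c              ∎
  where open ≡-Reasoning

sumℤ-distrib-+ : ∀ {m} (f g : Fin m → ℤ) → sumℤ (λ i → f i + g i) ≡ sumℤ f + sumℤ g
sumℤ-distrib-+ {zero} f g = refl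
sumℤ-distrib-+ {suc m} f g = begin
  (f zero + g zero) + sumℤ (λ i → f (suc i) + g (suc i))
    ≡⟨ cong (λ t → (f zero + g zero) + t) (sumℤ-distrib-+ (f ∘ suc) (g ∘ suc)) ⟩
  (f zero + g zero) + (sumℤ (f ∘ suc) + sumℤ (g ∘ suc))
    ≡⟨ interchange (f zero) (g zero) (sumℤ (f ∘ suc)) (sumℤ (g ∘ suc)) ⟩
  (f zero + sumℤ (f ∘ suc)) + (g zero + sumℤ (g ∘ suc))
    ∎
  where
  open ≡-Reasoning
  interchange : ∀ a b c d → (a + b) + (c + d) ≡ (a + c) + (b + d)
  interchange = solve-∀

sumℤ-*ˡ : ∀ {m} c (f : Fin m → ℤ) → sumℤ (λ i → c * f i) ≡ c * sumℤ f
sumℤ-*ˡ {zero} c f = sym (ℤP.*-zeroʳ c)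
sumℤ-*ˡ {suc m} c f =
  trans (cong (λ t → c * f zero + t) (sumℤ-*ˡ c (f ∘ suc))) (sym (ℤP.*-distribˡ-+ c _ _))

sumℤ-neg : ∀ {m} (f : Fin m → ℤ) → sumℤ (λ i → - f i) ≡ - sumℤ f
sumℤ-neg {zero} f = refl
sumℤ-neg {suc m} f =
  trans (cong (λ t → - f zero + t) (sumℤ-neg (f ∘ suc))) (sym (ℤP.neg-distrib-+ (f zero) _))

sumℤ-comm : ∀ {a b} (f : Fin a → Fin b → ℤ) →
            sumℤ (λ i → sumℤ (f i)) ≡ sumℤ (λ j → sumℤ (λ i → f i j))
sumℤ-comm {zero} {b} f = sym (sumℤ-zero b)
sumℤ-comm {suc a} f = trans (cong (λ t → sumℤ (f zero) + t) (sumℤ-comm (f ∘ suc)))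
  (sym (sumℤ-distrib-+ (f zero) (λ j → sumℤ (λ i → f (suc i) j))))

sumℤ-init-last : ∀ {m} (f : Fin (suc m) → ℤ) → sumℤ f ≡ sumℤ (f ∘ inject₁) + f (fromℕ m)
sumℤ-init-last {zero} f = trans (ℤP.+-identityʳ (f zero)) (sym (ℤP.+-identityˡ (f zero)))
sumℤ-init-last {suc m} f = trans (cong (λ t → f zero + t) (sumℤ-init-last (f ∘ suc)))
  (sym (ℤP.+-assoc (f zero) (sumℤ (f ∘ suc ∘ inject₁)) (f (suc (fromℕ m)))))

sumℤ-basis-* : ∀ {m} (k : Fin m) (f : Fin m → ℤ) → sumℤ (λ i → basis k i * f i) ≡ f k
sumℤ-basis-* {suc m} zero f = begin
  basis {suc m} zero zero * f zero + sumℤ (λ i → basis zero (suc i) * f (suc i))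
    ≡⟨ cong₂ _+_ (ℤP.*-identityˡ (f zero)) (sumℤ-cong (λ i → ℤP.*-zeroˡ (f (suc i)))) ⟩
  f zero + sumℤ {m} (λ _ → 0ℤ)
    ≡⟨ cong (λ t → f zero + t) (sumℤ-zero m) ⟩
  f zero + 0ℤ
    ≡⟨ ℤP.+-identityʳ (f zero) ⟩
  f zero
    ∎
  where open ≡-Reasoning
sumℤ-basis-* {suc m} (suc k) f = begin
  basis (suc k) zero * f zero + sumℤ (λ i → basis (suc k) (suc i) * f (suc i))
    ≡⟨ cong₂ _+_ (ℤP.*-zeroˡ (f zero))
         (sumℤ-cong (λ i → cong (_* f (suc i)) (basis-injective suc FinP.suc-injective k i))) ⟩
  0ℤ + sumℤ (λ i → basis k i * f (suc i))
    ≡⟨ ℤP.+-identityˡ _ ⟩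
  sumℤ (λ i → basis k i * f (suc i))
    ≡⟨ sumℤ-basis-* k (f ∘ suc) ⟩
  f (suc k)
    ∎
  where open ≡-Reasoning

sumℤ-*-basis : ∀ {m} (k : Fin m) (f : Fin m → ℤ) → sumℤ (λ i → f i * basis i k) ≡ f k
sumℤ-*-basis k f = trans
  (sumℤ-cong (λ i → trans (ℤP.*-comm (f i) _) (cong (_* f i) (basis-sym i k))))
  (sumℤ-basis-* k f)

sumℤ-basis : ∀ {m} (i : Fin m) → sumℤ (basis i) ≡ 1ℤ
sumℤ-basis i = trans (sumℤ-cong (λ j → sym (ℤP.*-identityʳ (basis i j)))) (sumℤ-basis-* i (λ _ → 1ℤ))

x-y≡z⇒x≡z+y : ∀ x y z → x - y ≡ z → x ≡ z + y
x-y≡z⇒x≡z+y x y z x-y≡z = trans (split x y) (cong (_+ y) x-y≡z)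
  where
  split : ∀ x y → x ≡ (x - y) + y
  split = solve-∀

x+y≡0⇒y≡-1*x : ∀ x y → x + y ≡ 0ℤ → y ≡ -1ℤ * x
x+y≡0⇒y≡-1*x x y x+y≡0 = trans (rearrange x y) (trans (cong (λ t → -1ℤ * x + t) x+y≡0) (ℤP.+-identityʳ (-1ℤ * x)))
  where
  rearrange : ∀ x y → y ≡ -1ℤ * x + (x + y)
  rearrange = solve-∀

sumBelow : ℕ → (ℕ → ℤ) → ℤ
sumBelow k f = sumℤ {k} (f ∘ toℕ)

sumBelow-suc : ∀ k f → sumBelow (suc k) f ≡ sumBelow k f + f k
sumBelow-suc k f = trans (sumℤ-init-last {k} (f ∘ toℕ))
  (cong₂ _+_ (sumℤ-cong {k} (cong f ∘ FinP.toℕ-inject₁)) (cong f (FinP.toℕ-fromℕ k)))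

sumBelow-cong : ∀ k {f g : ℕ → ℤ} → (∀ i → i ℕ.< k → f i ≡ g i) → sumBelow k f ≡ sumBelow k g
sumBelow-cong k f≗g = sumℤ-cong (λ i → f≗g (toℕ i) (FinP.toℕ<n i))

sumBelow-reverse : ∀ k f → sumBelow k f ≡ sumBelow k (λ i → f (k ∸ suc i))
sumBelow-reverse zero f = refl
sumBelow-reverse (suc k) f = begin
  sumBelow (suc k) f                   ≡⟨ sumBelow-suc k f ⟩
  sumBelow k f + f k                   ≡⟨ ℤP.+-comm (sumBelow k f) (f k) ⟩
  f k + sumBelow k f                   ≡⟨ cong (λ t → f k + t) (sumBelow-reverse k f) ⟩
  f k + sumBelow k (λ i → f (k ∸ suc i)) ∎
  where open ≡-Reasoning

≈E-refl : ∀ {n} {a : Elem n} → a ≈E a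
≈E-refl i = refl

≈E-sym : ∀ {n} {a b : Elem n} → a ≈E b → b ≈E a
≈E-sym a≈b i = sym (a≈b i)

≈E-trans : ∀ {n} {a b c : Elem n} → a ≈E b → b ≈E c → a ≈E c
≈E-trans a≈b b≈c i = trans (a≈b i) (b≈c i)

≡⇒≈E : ∀ {n} {a b : Elem n} → a ≡ b → a ≈E b
≡⇒≈E refl = ≈E-refl

≈E-setoid : ℕ → Setoid _ _
≈E-setoid n = record
  { Carrier = Elem n
  ; _≈_ = _≈E_
  ; isEquivalence = record { refl = ≈E-refl ; sym = ≈E-sym ; trans = ≈E-trans }
  }

sumE-at : ∀ {n m} (f : Fin m → Elem n) j → sumE f j ≡ sumℤ (λ i → f i j)
sumE-at {m = zero} f j = refl
sumE-at {m = suc m} f j = cong (λ t → f zero j + t) (sumE-at (f ∘ suc) j)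

sumE-cong : ∀ {n m} {f g : Fin m → Elem n} → (∀ i → f i ≈E g i) → sumE f ≈E sumE g
sumE-cong {f = f} {g} f≈g j =
  trans (sumE-at f j) (trans (sumℤ-cong (λ i → f≈g i j)) (sym (sumE-at g j)))

⊕-cong : ∀ {n} {a a' b b' : Elem n} → a ≈E a' → b ≈E b' → (a ⊕ b) ≈E (a' ⊕ b')
⊕-cong a≈a' b≈b' j = cong₂ _+_ (a≈a' j) (b≈b' j)

•-congʳ : ∀ {n} c {a a' : Elem n} → a ≈E a' → (c • a) ≈E (c • a')
•-congʳ c a≈a' j = cong (c *_) (a≈a' j)

•-distribˡ-⊕ : ∀ {n} c (a b : Elem n) → (c • (a ⊕ b)) ≈E ((c • a) ⊕ (c • b))
•-distribˡ-⊕ c a b j = ℤP.*-distribˡ-+ c (a j) (b j)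

•-distribʳ-+ : ∀ {n} c d (a : Elem n) → ((c + d) • a) ≈E ((c • a) ⊕ (d • a))
•-distribʳ-+ c d a j = ℤP.*-distribʳ-+ (a j) c d

•-assoc : ∀ {n} c d (a : Elem n) → (c • (d • a)) ≈E ((c * d) • a)
•-assoc c d a j = sym (ℤP.*-assoc c d (a j))

•-comm : ∀ {n} c d (a : Elem n) → (c • (d • a)) ≈E (d • (c • a))
•-comm c d a j = begin
  c * (d * a j)   ≡⟨ ℤP.*-assoc c d (a j) ⟨
  (c * d) * a j   ≡⟨ cong (_* a j) (ℤP.*-comm c d) ⟩
  (d * c) * a j   ≡⟨ ℤP.*-assoc d c (a j) ⟩
  d * (c * a j)   ∎
  where open ≡-Reasoning

0•-zero : ∀ {n} (a : Elem n) → (0ℤ • a) ≈E zeroE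
0•-zero a j = ℤP.*-zeroˡ (a j)

sumE-distrib-⊕ : ∀ {n m} (f g : Fin m → Elem n) → sumE (λ i → f i ⊕ g i) ≈E (sumE f ⊕ sumE g)
sumE-distrib-⊕ f g j = begin
  sumE (λ i → f i ⊕ g i) j                       ≡⟨ sumE-at (λ i → f i ⊕ g i) j ⟩
  sumℤ (λ i → f i j + g i j)                     ≡⟨ sumℤ-distrib-+ (λ i → f i j) (λ i → g i j) ⟩
  sumℤ (λ i → f i j) + sumℤ (λ i → g i j)        ≡⟨ cong₂ _+_ (sumE-at f j) (sumE-at g j) ⟨
  sumE f j + sumE g j                            ∎
  where open ≡-Reasoning

sumE-• : ∀ {n m} c (f : Fin m → Elem n) → sumE (λ i → c • f i) ≈E (c • sumE f)
sumE-• c f j = begin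
  sumE (λ i → c • f i) j     ≡⟨ sumE-at (λ i → c • f i) j ⟩
  sumℤ (λ i → c * f i j)     ≡⟨ sumℤ-*ˡ c (λ i → f i j) ⟩
  c * sumℤ (λ i → f i j)     ≡⟨ cong (c *_) (sumE-at f j) ⟨
  c * sumE f j               ∎
  where open ≡-Reasoning

sumE-comm : ∀ {n a b} (f : Fin a → Fin b → Elem n) →
            sumE (λ i → sumE (f i)) ≈E sumE (λ j → sumE (λ i → f i j))
sumE-comm f k = begin
  sumE (λ i → sumE (f i)) k               ≡⟨ sumE-at (λ i → sumE (f i)) k ⟩
  sumℤ (λ i → sumE (f i) k)               ≡⟨ sumℤ-cong (λ i → sumE-at (f i) k) ⟩
  sumℤ (λ i → sumℤ (λ j → f i j k))       ≡⟨ sumℤ-comm (λ i j → f i j k) ⟩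
  sumℤ (λ j → sumℤ (λ i → f i j k))       ≡⟨ sumℤ-cong (λ j → sumE-at (λ i → f i j) k) ⟨
  sumℤ (λ j → sumE (λ i → f i j) k)       ≡⟨ sumE-at (λ j → sumE (λ i → f i j)) k ⟨
  sumE (λ j → sumE (λ i → f i j)) k       ∎
  where open ≡-Reasoning

sumE-basis-• : ∀ {n m} (k : Fin m) (f : Fin m → Elem n) → sumE (λ i → basis k i • f i) ≈E f k
sumE-basis-• k f j = trans (sumE-at (λ i → basis k i • f i) j) (sumℤ-basis-* k (λ i → f i j))

sumℤ-sumE : ∀ {n m} (c : Fin m → ℤ) (f : Fin m → Elem n) →
            sumℤ (sumE (λ i → c i • f i)) ≡ sumℤ (λ i → c i * sumℤ (f i))
sumℤ-sumE c f = begin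
  sumℤ (sumE (λ i → c i • f i))            ≡⟨ sumℤ-cong (sumE-at (λ i → c i • f i)) ⟩
  sumℤ (λ j → sumℤ (λ i → c i * f i j))    ≡⟨ sumℤ-comm (λ i j → c i * f i j) ⟨
  sumℤ (λ i → sumℤ (λ j → c i * f i j))    ≡⟨ sumℤ-cong (λ i → sumℤ-*ˡ (c i) (f i)) ⟩
  sumℤ (λ i → c i * sumℤ (f i))            ∎
  where open ≡-Reasoning

sumE-zero : ∀ {n m} (f : Fin m → Elem n) → (∀ i → f i ≈E zeroE) → sumE f ≈E zeroE
sumE-zero {m = m} f f≈0 j = trans (sumE-at f j) (trans (sumℤ-cong (λ i → f≈0 i j)) (sumℤ-zero m))

record IsLinear {n} (F : Elem n → Elem n) : Set where
  field
    cong-≈ : ∀ {a b} → a ≈E b → F a ≈E F b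
    hom-⊕ : ∀ a b → F (a ⊕ b) ≈E (F a ⊕ F b)
    hom-• : ∀ c a → F (c • a) ≈E (c • F a)

  hom-zero : F zeroE ≈E zeroE
  hom-zero = ≈E-trans (cong-≈ (≈E-sym (0•-zero zeroE)))
    (≈E-trans (hom-• 0ℤ zeroE) (0•-zero (F zeroE)))

  hom-sum : ∀ {m} (f : Fin m → Elem n) → F (sumE f) ≈E sumE (F ∘ f)
  hom-sum {zero} f = hom-zero
  hom-sum {suc m} f = ≈E-trans (hom-⊕ (f zero) (sumE (f ∘ suc)))
    (⊕-cong {a = F (f zero)} ≈E-refl (hom-sum (f ∘ suc)))

  hom-comb : ∀ {m} (c : Fin m → ℤ) (f : Fin m → Elem n) →
             F (sumE (λ i → c i • f i)) ≈E sumE (λ i → c i • F (f i))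
  hom-comb c f = ≈E-trans (hom-sum (λ i → c i • f i)) (sumE-cong (λ i → hom-• (c i) (f i)))

iter-linear : ∀ {n} {F : Elem n → Elem n} → IsLinear F → ∀ k → IsLinear (iter k F)
iter-linear L zero = record
  { cong-≈ = λ a≈b → a≈b ; hom-⊕ = λ a b → ≈E-refl ; hom-• = λ c a → ≈E-refl }
iter-linear {F = F} L (suc k) = record
  { cong-≈ = λ a≈b → cong-≈ L (cong-≈ Fᵏ a≈b)
  ; hom-⊕ = λ a b → ≈E-trans (cong-≈ L (hom-⊕ Fᵏ a b)) (hom-⊕ L (iter k F a) (iter k F b))
  ; hom-• = λ c a → ≈E-trans (cong-≈ L (hom-• Fᵏ c a)) (hom-• L c (iter k F a))
  }
  where
  open IsLinear
  Fᵏ : IsLinear (iter k F)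
  Fᵏ = iter-linear L k

iter-+ : ∀ {A : Set} a b (f : A → A) x → iter (a ℕ.+ b) f x ≡ iter a f (iter b f x)
iter-+ zero b f x = refl
iter-+ (suc a) b f x = cong f (iter-+ a b f x)

iter-comm : ∀ {A : Set} a b (f : A → A) x → iter a f (iter b f x) ≡ iter b f (iter a f x)
iter-comm a b f x = begin
  iter a f (iter b f x)   ≡⟨ iter-+ a b f x ⟨
  iter (a ℕ.+ b) f x      ≡⟨ cong (λ k → iter k f x) (ℕP.+-comm a b) ⟩
  iter (b ℕ.+ a) f x      ≡⟨ iter-+ b a f x ⟩
  iter b f (iter a f x)   ∎
  where open ≡-Reasoning

-- Congruences

infix 4 _≡_mod_ _≈_mod_

record _≡_mod_ (a b N : ℤ) : Set where
  constructor ≡-mod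
  field
    quotient : ℤ
    equality : a ≡ b + quotient * N

≡⇒≡-mod : ∀ {a b N} → a ≡ b → a ≡ b mod N
≡⇒≡-mod {b = b} {N} refl = ≡-mod 0ℤ (sym (trans (cong (λ t → b + t) (ℤP.*-zeroˡ N)) (ℤP.+-identityʳ b)))

≡-mod-refl : ∀ {a N} → a ≡ a mod N
≡-mod-refl = ≡⇒≡-mod refl

≡-mod-sym : ∀ {a b N} → a ≡ b mod N → b ≡ a mod N
≡-mod-sym {b = b} {N} (≡-mod k a≡b+kN) = ≡-mod (- k) (trans (cancel b k N) (cong (λ t → t + - k * N) (sym a≡b+kN)))
  where
  cancel : ∀ b k N → b ≡ (b + k * N) + - k * N
  cancel = solve-∀

≡-mod-trans : ∀ {a b c N} → a ≡ b mod N → b ≡ c mod N → a ≡ c mod N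
≡-mod-trans {c = c} {N} (≡-mod k a≡b+kN) (≡-mod l b≡c+lN) =
  ≡-mod (l + k) (trans a≡b+kN (trans (cong (λ t → t + k * N) b≡c+lN) (regroup c l k N)))
  where
  regroup : ∀ c l k N → (c + l * N) + k * N ≡ c + (l + k) * N
  regroup = solve-∀

+-cong-mod : ∀ {a a' b b' N} → a ≡ a' mod N → b ≡ b' mod N → a + b ≡ a' + b' mod N
+-cong-mod {a' = a'} {b' = b'} {N} (≡-mod k a≡) (≡-mod l b≡) =
  ≡-mod (k + l) (trans (cong₂ _+_ a≡ b≡) (regroup a' b' k l N))
  where
  regroup : ∀ a' b' k l N → (a' + k * N) + (b' + l * N) ≡ (a' + b') + (k + l) * N
  regroup = solve-∀

*-cong-mod : ∀ {a a' b b' N} → a ≡ a' mod N → b ≡ b' mod N → a * b ≡ a' * b' mod N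
*-cong-mod {a' = a'} {b' = b'} {N} (≡-mod k a≡) (≡-mod l b≡) =
  ≡-mod (a' * l + k * b' + k * l * N) (trans (cong₂ _*_ a≡ b≡) (expand a' b' k l N))
  where
  expand : ∀ a' b' k l N → (a' + k * N) * (b' + l * N) ≡ a' * b' + (a' * l + k * b' + k * l * N) * N
  expand = solve-∀

sumℤ-cong-mod : ∀ {k N} {f g : Fin k → ℤ} → (∀ i → f i ≡ g i mod N) → sumℤ f ≡ sumℤ g mod N
sumℤ-cong-mod {zero} f≡g = ≡-mod-refl
sumℤ-cong-mod {suc k} f≡g = +-cong-mod (f≡g zero) (sumℤ-cong-mod (f≡g ∘ suc))

record _≈_mod_ {n} (x y : Elem n) (q : ℕ) : Set where
  constructor ≈-mod
  field
    quotient : Elem n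
    equality : x ≈E (y ⊕ ((+ q) • quotient))

≈⇒≈-mod : ∀ {n q} {x y : Elem n} → x ≈E y → x ≈ y mod q
≈⇒≈-mod {q = q} {y = y} x≈y =
  ≈-mod zeroE (λ j → trans (x≈y j) (sym (trans (cong (λ t → y j + t) (ℤP.*-zeroʳ (+ q))) (ℤP.+-identityʳ (y j)))))

≈-mod-trans : ∀ {n q} {x y z : Elem n} → x ≈ y mod q → y ≈ z mod q → x ≈ z mod q
≈-mod-trans {q = q} {z = z} (≈-mod c x≈) (≈-mod d y≈) =
  ≈-mod (d ⊕ c) (λ j → trans (x≈ j) (trans (cong (λ t → t + + q * c j) (y≈ j)) (regroup (z j) (+ q) (d j) (c j))))
  where
  regroup : ∀ z q d c → (z + q * d) + q * c ≡ z + q * (d + c)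
  regroup = solve-∀

≈-mod-sym : ∀ {n q} {x y : Elem n} → x ≈ y mod q → y ≈ x mod q
≈-mod-sym {q = q} {y = y} (≈-mod c x≈) =
  ≈-mod (-1ℤ • c) (λ j → trans (cancel (y j) (+ q) (c j)) (cong (λ t → t + + q * (-1ℤ * c j)) (sym (x≈ j))))
  where
  cancel : ∀ y q c → y ≡ (y + q * c) + q * (-1ℤ * c)
  cancel = solve-∀

≈-mod-resp : ∀ {n q} {x x' y y' : Elem n} → x ≈E x' → y ≈E y' → x ≈ y mod q → x' ≈ y' mod q
≈-mod-resp x≈x' y≈y' x≈y = ≈-mod-trans (≈⇒≈-mod (≈E-sym x≈x')) (≈-mod-trans x≈y (≈⇒≈-mod y≈y'))

linear-cong-mod : ∀ {n q} {x y : Elem n} {F : Elem n → Elem n} → IsLinear F → x ≈ y mod q → F x ≈ F y mod q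
linear-cong-mod {q = q} {y = y} {F} L (≈-mod c x≈) =
  ≈-mod (F c) (≈E-trans (cong-≈ x≈) (≈E-trans (hom-⊕ y ((+ q) • c)) (⊕-cong {a = F y} ≈E-refl (hom-• (+ q) c))))
  where open IsLinear L

gcdAll-∣ : ∀ {k} (f : Fin k → ℕ) i → gcdAll f ND.∣ f i
gcdAll-∣ f zero = gcd[m,n]∣m (f zero) (gcdAll (f ∘ suc))
gcdAll-∣ f (suc i) = ND.∣-trans (gcd[m,n]∣n (f zero) (gcdAll (f ∘ suc))) (gcdAll-∣ (f ∘ suc) i)

column≈basis-mod-gcd : ∀ {n} (A : Mat n) i → (λ j → A j i) ≈ basis i mod gcdMinusI A
column≈basis-mod-gcd A i = ≈-mod c A≡I+dc
  where
  d : ℕ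
  d = gcdMinusI A
  d∣entry : ∀ j → (+ d) DS.∣ (A j i - idMat j i)
  d∣entry j = DS.∣ᵤ⇒∣ (ND.∣-trans (gcdAll-∣ (λ k → gcdAll (λ l → ∣ A k l - idMat k l ∣)) j)
                                  (gcdAll-∣ (λ l → ∣ A j l - idMat j l ∣) i))
  c : Elem _
  c j = DS._∣_.quotient (d∣entry j)
  swap : ∀ c d e → c * d + e ≡ e + d * c
  swap = solve-∀
  A≡I+dc : (λ j → A j i) ≈E (basis i ⊕ ((+ d) • c))
  A≡I+dc j = trans (x-y≡z⇒x≡z+y (A j i) (idMat j i) (c j * + d) (DS._∣_.equality (d∣entry j)))
                   (trans (swap (c j) (+ d) (idMat j i)) (cong (λ t → t + + d * c j) (basis-sym j i)))

-- Sums of squares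

sumℕ : ∀ {k} → (Fin k → ℕ) → ℕ
sumℕ {zero} f = 0
sumℕ {suc k} f = f zero ℕ.+ sumℕ (f ∘ suc)

sumℕ≡0⇒≡0 : ∀ {k} (f : Fin k → ℕ) → sumℕ f ≡ 0 → ∀ i → f i ≡ 0
sumℕ≡0⇒≡0 f eq zero = ℕP.m+n≡0⇒m≡0 (f zero) eq
sumℕ≡0⇒≡0 f eq (suc i) = sumℕ≡0⇒≡0 (f ∘ suc) (ℕP.m+n≡0⇒n≡0 (f zero) eq) i

sumℕ≡1⇒single : ∀ {k} (f : Fin k → ℕ) → sumℕ f ≡ 1 →
                Σ (Fin k) λ c → f c ≡ 1 × (∀ i → i ≢ c → f i ≡ 0)
sumℕ≡1⇒single {suc k} f eq with f zero in f₀≡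
... | 0 with sumℕ≡1⇒single (f ∘ suc) eq
...   | c , fc≡1 , rest = suc c , fc≡1 , λ where
        zero _ → f₀≡
        (suc i) i≢c → rest i (i≢c ∘ cong suc)
sumℕ≡1⇒single {suc k} f eq | 1 = zero , f₀≡ , λ where
  zero 0≢0 → ⊥-elim (0≢0 refl)
  (suc i) _ → sumℕ≡0⇒≡0 (f ∘ suc) (ℕP.suc-injective eq) i

sumSq : ∀ {k} → (Fin k → ℤ) → ℤ
sumSq y = sumℤ (λ i → y i * y i)

sqℕ : ℤ → ℕ
sqℕ y = ∣ y ∣ ℕ.* ∣ y ∣

y*y≡sqℕ : ∀ y → y * y ≡ + sqℕ y
y*y≡sqℕ (+ zero) = refl
y*y≡sqℕ +[1+ k ] = refl
y*y≡sqℕ -[1+ k ] = refl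

sqℕ≡0⇒≡0 : ∀ y → sqℕ y ≡ 0 → y ≡ 0ℤ
sqℕ≡0⇒≡0 y eq with ℕP.m*n≡0⇒m≡0∨n≡0 ∣ y ∣ eq
... | inj₁ ∣y∣≡0 = ℤP.∣i∣≡0⇒i≡0 ∣y∣≡0
... | inj₂ ∣y∣≡0 = ℤP.∣i∣≡0⇒i≡0 ∣y∣≡0

∣i∣≡1⇒±1 : ∀ ε → ∣ ε ∣ ≡ 1 → ε ≡ 1ℤ ⊎ ε ≡ -1ℤ
∣i∣≡1⇒±1 +[1+ zero ] _ = inj₁ refl
∣i∣≡1⇒±1 -[1+ zero ] _ = inj₂ refl

∣i^k∣≡1 : ∀ {ε} k → ∣ ε ∣ ≡ 1 → ∣ ε ℤ.^ k ∣ ≡ 1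
∣i^k∣≡1 zero _ = refl
∣i^k∣≡1 {ε} (suc k) ∣ε∣≡1 = trans (ℤP.abs-* ε (ε ℤ.^ k)) (cong₂ ℕ._*_ ∣ε∣≡1 (∣i^k∣≡1 k ∣ε∣≡1))

sumℤ-squares : ∀ {k} (y : Fin k → ℤ) → sumSq y ≡ + sumℕ (sqℕ ∘ y)
sumℤ-squares {zero} y = refl
sumℤ-squares {suc k} y = begin
  y zero * y zero + sumℤ (λ i → y (suc i) * y (suc i))
    ≡⟨ cong₂ _+_ (y*y≡sqℕ (y zero)) (sumℤ-squares (y ∘ suc)) ⟩
  + sqℕ (y zero) + + sumℕ (sqℕ ∘ y ∘ suc)
    ≡⟨ ℤP.pos-+ (sqℕ (y zero)) (sumℕ (sqℕ ∘ y ∘ suc)) ⟨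
  + sumℕ (sqℕ ∘ y)
    ∎
  where open ≡-Reasoning

sumℤ-squared-deviation : ∀ {k} a c (x : Fin k → ℤ) →
  sumSq (λ i → a * x i - c) ≡ a * a * sumSq x - + 2 * a * c * sumℤ x + + k * (c * c)
sumℤ-squared-deviation {k} a c x = begin
  sumℤ (λ i → (a * x i - c) * (a * x i - c))
    ≡⟨ sumℤ-cong (λ i → expand a c (x i)) ⟩
  sumℤ (λ i → (a * a * (x i * x i) + - (+ 2 * a * c) * x i) + c * c)
    ≡⟨ sumℤ-distrib-+ (λ i → a * a * (x i * x i) + - (+ 2 * a * c) * x i) (λ _ → c * c) ⟩
  sumℤ (λ i → a * a * (x i * x i) + - (+ 2 * a * c) * x i) + sumℤ {k} (λ _ → c * c)
    ≡⟨ cong₂ _+_ (sumℤ-distrib-+ (λ i → a * a * (x i * x i)) (λ i → - (+ 2 * a * c) * x i)) (sumℤ-const k (c * c)) ⟩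
  (sumℤ (λ i → a * a * (x i * x i)) + sumℤ (λ i → - (+ 2 * a * c) * x i)) + + k * (c * c)
    ≡⟨ cong (λ t → t + + k * (c * c)) (cong₂ _+_ (sumℤ-*ˡ (a * a) (λ i → x i * x i)) (sumℤ-*ˡ (- (+ 2 * a * c)) x)) ⟩
  (a * a * sumSq x + - (+ 2 * a * c) * sumℤ x) + + k * (c * c)
    ≡⟨ cong (λ t → t + + k * (c * c)) (cong (λ t → a * a * sumSq x + t) (sym (ℤP.neg-distribˡ-* (+ 2 * a * c) (sumℤ x)))) ⟩
  a * a * sumSq x - + 2 * a * c * sumℤ x + + k * (c * c)
    ∎
  where
  open ≡-Reasoning
  expand : ∀ a c x → (a * x - c) * (a * x - c) ≡ (a * a * (x * x) + - (+ 2 * a * c) * x) + c * c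
  expand = solve-∀

sumSq-bound : ∀ {k} (x : Fin (suc k) → ℤ) →
              + (2 ℕ.+ k) * sumSq x - sumℤ x * sumℤ x ≡ + suc k → sumℕ (sqℕ ∘ x) ℕ.≤ suc k
sumSq-bound {k} x eq = N*d≥0⇒Q≤N (N - + Q) (sumℕ (sqℕ ∘ dev)) N*[N-Q]≡ΣΔ² refl
  where
  N S : ℤ
  N = + suc k
  S = sumℤ x
  Q : ℕ
  Q = sumℕ (sqℕ ∘ x)
  dev : Fin (suc k) → ℤ
  dev i = N * x i - S
  regroup : ∀ N Q S → N * N * Q - + 2 * N * S * S + N * (S * S) ≡ N * (((+ 1 + N) * Q - S * S) - Q)
  regroup = solve-∀
  N*[N-Q]≡ΣΔ² : N * (N - + Q) ≡ + sumℕ (sqℕ ∘ dev)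
  N*[N-Q]≡ΣΔ² = begin
    N * (N - + Q)                                                ≡⟨ cong (λ t → N * (N - t)) (sumℤ-squares x) ⟨
    N * (N - sumSq x)                                            ≡⟨ cong (λ t → N * (t - sumSq x)) eq' ⟨
    N * ((+ 1 + N) * sumSq x - S * S - sumSq x)                  ≡⟨ regroup N (sumSq x) S ⟨
    N * N * sumSq x - + 2 * N * S * S + N * (S * S)              ≡⟨ sumℤ-squared-deviation N S x ⟨
    sumSq dev                                                    ≡⟨ sumℤ-squares dev ⟩
    + sumℕ (sqℕ ∘ dev)                                           ∎
    where
    open ≡-Reasoning
    eq' : (+ 1 + N) * sumSq x - S * S ≡ N
    eq' = trans (cong (λ t → t * sumSq x - S * S) (sym (ℤP.pos-+ 1 (suc k)))) eq
  N*d≥0⇒Q≤N : ∀ d t → N * d ≡ + t → d ≡ N - + Q → Q ℕ.≤ suc k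
  N*d≥0⇒Q≤N (+ d) t _ d≡N-Q = subst (Q ℕ.≤_) d+Q≡N (ℕP.m≤n+m Q d)
    where
    d+Q≡N : d ℕ.+ Q ≡ suc k
    d+Q≡N = ℤP.+-injective (sym (trans (x-y≡z⇒x≡z+y N (+ Q) (+ d) (sym d≡N-Q)) (sym (ℤP.pos-+ d Q))))
  N*d≥0⇒Q≤N -[1+ d ] t ()

sumSq-all-equal : ∀ {k} (x : Fin k → ℤ) ε → ε * ε ≡ 1ℤ → sumℤ x ≡ ε * + k → sumSq x ≡ + k → ∀ i → x i ≡ ε
sumSq-all-equal {k} x ε ε²≡1 S≡εk Q≡k i =
  trans (split (x i) ε) (trans (cong (_+ ε) (sqℕ≡0⇒≡0 (dev i) (sumℕ≡0⇒≡0 (sqℕ ∘ dev) Σsq≡0 i))) (ℤP.+-identityˡ ε))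
  where
  dev : Fin k → ℤ
  dev i = 1ℤ * x i - ε
  split : ∀ x ε → x ≡ (1ℤ * x - ε) + ε
  split = solve-∀
  expand : ∀ K ε → + 1 * + 1 * K - + 2 * + 1 * ε * (ε * K) + K * (ε * ε) ≡ K + (- K) * (ε * ε)
  expand = solve-∀
  Σsq≡0 : sumℕ (sqℕ ∘ dev) ≡ 0
  Σsq≡0 = ℤP.+-injective (begin
    + sumℕ (sqℕ ∘ dev)                                                    ≡⟨ sumℤ-squares dev ⟨
    sumSq dev                                                             ≡⟨ sumℤ-squared-deviation 1ℤ ε x ⟩
    1ℤ * 1ℤ * sumSq x - + 2 * 1ℤ * ε * sumℤ x + + k * (ε * ε)            ≡⟨ cong₂ (λ Q S → 1ℤ * 1ℤ * Q - + 2 * 1ℤ * ε * S + + k * (ε * ε)) Q≡k S≡εk ⟩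
    1ℤ * 1ℤ * + k - + 2 * 1ℤ * ε * (ε * + k) + + k * (ε * ε)             ≡⟨ expand (+ k) ε ⟩
    + k + (- + k) * (ε * ε)                                               ≡⟨ cong (λ t → + k + (- + k) * t) ε²≡1 ⟩
    + k + (- + k) * 1ℤ                                                    ≡⟨ cancel (+ k) ⟩
    0ℤ                                                                    ∎)
    where
    open ≡-Reasoning
    cancel : ∀ K → K + (- K) * 1ℤ ≡ 0ℤ
    cancel = solve-∀

-- The equation p q = (p - 1) + s²

∣∧<⇒≡0 : ∀ {d t} → d ND.∣ t → t ℕ.< d → t ≡ 0
∣∧<⇒≡0 {t = zero} _ _ = refl
∣∧<⇒≡0 {t = suc t} d∣t t<d = ⊥-elim (ND.>⇒∤ t<d d∣t)

s[2+s]≡p*q-solutions : ∀ m q s → Prime (2 ℕ.+ m) → s ℕ.* (2 ℕ.+ s) ≡ (2 ℕ.+ m) ℕ.* q → q ℕ.≤ m →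
                       (q ≡ 0 × s ≡ 0) ⊎ (q ≡ m × s ≡ m)
s[2+s]≡p*q-solutions m q s p-prime eq q≤m =
  case euclidsLemma s (2 ℕ.+ s) p-prime (ND.divides q (trans eq (ℕP.*-comm p q))) of λ where
    (inj₁ p∣s) → let s≡0 = ∣∧<⇒≡0 p∣s (s≤s (ℕP.m≤n⇒m≤1+n s≤m)) in
      inj₁ (ℕP.*-cancelˡ-≡ q 0 p (trans (sym eq) (trans (cong (λ t → t ℕ.* (2 ℕ.+ t)) s≡0) (sym (ℕP.*-zeroʳ p)))) , s≡0)
    (inj₂ p∣2+s) → let s≡m = ℕP.suc-injective (ℕP.suc-injective (ℕP.≤-antisym (s≤s (s≤s s≤m)) (ND.∣⇒≤ p∣2+s))) in
      inj₂ (ℕP.*-cancelˡ-≡ q m p (trans (sym eq) (trans (cong (λ t → t ℕ.* (2 ℕ.+ t)) s≡m) (ℕP.*-comm m p))) , s≡m)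
  where
  open ℕP.≤-Reasoning
  p : ℕ
  p = 2 ℕ.+ m
  s≤m : s ℕ.≤ m
  s≤m = ℕP.≮⇒≥ λ m<s → ℕP.<-irrefl refl (begin-strict
    s ℕ.* (2 ℕ.+ s)         ≡⟨ eq ⟩
    p ℕ.* q                 ≤⟨ ℕP.*-monoʳ-≤ p q≤m ⟩
    p ℕ.* m                 <⟨ s≤s (ℕP.m≤m+n (p ℕ.* m) (2 ℕ.+ (m ℕ.+ m))) ⟩
    suc (p ℕ.* m ℕ.+ (2 ℕ.+ (m ℕ.+ m)))  ≡⟨ expand m ⟨
    suc m ℕ.* (3 ℕ.+ m)     ≤⟨ ℕP.*-mono-≤ m<s (s≤s (s≤s m<s)) ⟩
    s ℕ.* (2 ℕ.+ s)         ∎)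
    where
    expand : ∀ m → suc m ℕ.* (3 ℕ.+ m) ≡ suc ((2 ℕ.+ m) ℕ.* m ℕ.+ (2 ℕ.+ (m ℕ.+ m)))
    expand = ℕ-Solver.solve-∀

p*q≡p-1+s²-solutions : ∀ m q s → Prime (2 ℕ.+ m) → (2 ℕ.+ m) ℕ.* q ≡ suc m ℕ.+ s ℕ.* s → q ℕ.≤ suc m →
                       (q ≡ 1 × s ≡ 1) ⊎ (q ≡ suc m × s ≡ suc m)
p*q≡p-1+s²-solutions m zero s _ eq _ = ⊥-elim (ℕP.0≢1+n (trans (sym (ℕP.*-zeroʳ (2 ℕ.+ m))) eq))
p*q≡p-1+s²-solutions m (suc q) s p-prime eq (s≤s q≤m) = reduce s s²≡1+pq
  where
  p : ℕ
  p = 2 ℕ.+ m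
  s²≡1+pq : s ℕ.* s ≡ suc (p ℕ.* q)
  s²≡1+pq = ℕP.+-cancelˡ-≡ (suc m) (s ℕ.* s) (suc (p ℕ.* q))
    (trans (sym eq) (trans (ℕP.*-suc p q) (shift m (p ℕ.* q))))
    where
    shift : ∀ m x → (2 ℕ.+ m) ℕ.+ x ≡ suc m ℕ.+ suc x
    shift = ℕ-Solver.solve-∀
  reduce : ∀ s → s ℕ.* s ≡ suc (p ℕ.* q) → (suc q ≡ 1 × s ≡ 1) ⊎ (suc q ≡ suc m × s ≡ suc m)
  reduce (suc s) e = case s[2+s]≡p*q-solutions m q s p-prime (trans (expand s) (ℕP.suc-injective e)) q≤m of λ where
      (inj₁ (q≡0 , s≡0)) → inj₁ (cong suc q≡0 , cong suc s≡0)
      (inj₂ (q≡m , s≡m)) → inj₂ (cong suc q≡m , cong suc s≡m)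
    where
    expand : ∀ s → s ℕ.* (2 ℕ.+ s) ≡ s ℕ.+ s ℕ.* suc s
    expand = ℕ-Solver.solve-∀

-- The ring ℤ[x]/(1 + x + ⋯ + x^(m+1))

module Cyclotomic (m : ℕ) where

  n : ℕ
  n = suc m

  p : ℕ
  p = suc n

  top : Fin n
  top = fromℕ m

  mulζ^ : ℕ → Elem n → Elem n
  mulζ^ k = iter k mulζ

  ζ^ : ℕ → Elem n
  ζ^ k = mulζ^ k oneE

  minusOnes : Elem n
  minusOnes _ = -1ℤ

  module ≈E-Reasoning = SetoidReasoning (≈E-setoid n)

  mulζ-linear : IsLinear (mulζ {n})
  mulζ-linear = record { cong-≈ = mulζ-cong ; hom-⊕ = mulζ-⊕ ; hom-• = mulζ-• }
    where
    mulζ-cong : ∀ {a b} → a ≈E b → mulζ a ≈E mulζ b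
    mulζ-cong a≈b zero = cong -_ (a≈b top)
    mulζ-cong a≈b (suc j) = cong₂ _-_ (a≈b (inject₁ j)) (a≈b top)
    mulζ-⊕ : ∀ a b → mulζ (a ⊕ b) ≈E (mulζ a ⊕ mulζ b)
    mulζ-⊕ a b zero = ℤP.neg-distrib-+ (a top) (b top)
    mulζ-⊕ a b (suc j) = interchange (a (inject₁ j)) (b (inject₁ j)) (a top) (b top)
      where
      interchange : ∀ x y z w → (x + y) - (z + w) ≡ (x - z) + (y - w)
      interchange = solve-∀
    mulζ-• : ∀ c a → mulζ (c • a) ≈E (c • mulζ a)
    mulζ-• c a zero = ℤP.neg-distribʳ-* c (a top)
    mulζ-• c a (suc j) = distrib c (a (inject₁ j)) (a top)
      where
      distrib : ∀ c x y → c * x - c * y ≡ c * (x - y)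
      distrib = solve-∀

  mulζ^-linear : ∀ k → IsLinear (mulζ^ k)
  mulζ^-linear = iter-linear mulζ-linear

  module mulζ = IsLinear mulζ-linear
  module mulζ^ k = IsLinear (mulζ^-linear k)

  mulζ^-≡ : ∀ {a b} x → a ≡ b → mulζ^ a x ≈E mulζ^ b x
  mulζ^-≡ x refl = ≈E-refl

  mulζ-basis-inject₁ : ∀ (j : Fin m) → mulζ (basis (inject₁ j)) ≈E basis (suc j)
  mulζ-basis-inject₁ j zero = cong -_ (basis-≢ (FinP.fromℕ≢inject₁ ∘ sym))
  mulζ-basis-inject₁ j (suc j') = begin
    basis (inject₁ j) (inject₁ j') - basis (inject₁ j) top  ≡⟨ cong₂ _-_ (basis-injective inject₁ FinP.inject₁-injective j j') (basis-≢ (FinP.fromℕ≢inject₁ ∘ sym)) ⟩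
    basis j j' - 0ℤ                                        ≡⟨ ℤP.+-identityʳ (basis j j') ⟩
    basis j j'                                             ≡⟨ basis-injective suc FinP.suc-injective j j' ⟨
    basis (suc j) (suc j')                                 ∎
    where open ≡-Reasoning

  mulζ-basis-top : mulζ (basis top) ≈E minusOnes
  mulζ-basis-top zero = cong -_ (basis-diag top)
  mulζ-basis-top (suc j) = cong₂ _-_ (basis-≢ {i = top} {j = inject₁ j} FinP.fromℕ≢inject₁) (basis-diag top)

  ζ^-basis : ∀ k (i : Fin n) → toℕ i ≡ k → ζ^ k ≈E basis i
  ζ^-basis zero zero _ = ≈E-refl
  ζ^-basis (suc k) (suc j) i≡k = ≈E-trans
    (mulζ.cong-≈ (ζ^-basis k (inject₁ j) (trans (FinP.toℕ-inject₁ j) (ℕP.suc-injective i≡k))))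
    (mulζ-basis-inject₁ j)

  ζ^-toℕ : ∀ (i : Fin n) → ζ^ (toℕ i) ≈E basis i
  ζ^-toℕ i = ζ^-basis (toℕ i) i refl

  ζ^n : ζ^ n ≈E minusOnes
  ζ^n = ≈E-trans (mulζ.cong-≈ (ζ^-basis m top (FinP.toℕ-fromℕ m))) mulζ-basis-top

  expansion : ∀ (x : Elem n) → x ≈E sumE (λ i → x i • ζ^ (toℕ i))
  expansion x j = sym (begin
    sumE (λ i → x i • ζ^ (toℕ i)) j    ≡⟨ sumE-at (λ i → x i • ζ^ (toℕ i)) j ⟩
    sumℤ (λ i → x i * ζ^ (toℕ i) j)    ≡⟨ sumℤ-cong (λ i → cong (x i *_) (ζ^-toℕ i j)) ⟩
    sumℤ (λ i → x i * basis i j)       ≡⟨ sumℤ-*-basis j x ⟩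
    x j                                ∎)
    where open ≡-Reasoning

  sum-ζ^ : sumE {m = p} (ζ^ ∘ toℕ) ≈E zeroE
  sum-ζ^ j = begin
    sumE {m = p} (ζ^ ∘ toℕ) j                               ≡⟨ sumE-at {m = p} (ζ^ ∘ toℕ) j ⟩
    sumBelow p (λ k → ζ^ k j)                               ≡⟨ sumBelow-suc n (λ k → ζ^ k j) ⟩
    sumℤ (λ (i : Fin n) → ζ^ (toℕ i) j) + ζ^ n j           ≡⟨ cong₂ _+_ (sumℤ-cong (λ i → trans (ζ^-toℕ i j) (basis-sym i j))) (ζ^n j) ⟩
    sumℤ (basis j) + -1ℤ                                    ≡⟨ cong (_+ -1ℤ) (sumℤ-basis j) ⟩
    0ℤ                                                      ∎
    where open ≡-Reasoning

  sum-mulζ^ : ∀ x → sumE {m = p} (λ k → mulζ^ (toℕ k) x) ≈E zeroE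
  sum-mulζ^ x = begin
      sumE (λ (k : Fin p) → mulζ^ (toℕ k) x)
    ≈⟨ sumE-cong (λ (k : Fin p) → mulζ^.cong-≈ (toℕ k) (expansion x)) ⟩
      sumE (λ (k : Fin p) → mulζ^ (toℕ k) (sumE (λ (i : Fin n) → x i • ζ^ (toℕ i))))
    ≈⟨ sumE-cong (λ (k : Fin p) → mulζ^.hom-comb (toℕ k) x (ζ^ ∘ toℕ)) ⟩
      sumE (λ (k : Fin p) → sumE (λ (i : Fin n) → x i • mulζ^ (toℕ k) (ζ^ (toℕ i))))
    ≈⟨ sumE-cong (λ (k : Fin p) → sumE-cong (λ (i : Fin n) → •-congʳ (x i) (≡⇒≈E (iter-comm (toℕ k) (toℕ i) mulζ oneE)))) ⟩
      sumE (λ (k : Fin p) → sumE (λ (i : Fin n) → x i • mulζ^ (toℕ i) (ζ^ (toℕ k))))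
    ≈⟨ sumE-comm (λ (k : Fin p) (i : Fin n) → x i • mulζ^ (toℕ i) (ζ^ (toℕ k))) ⟩
      sumE (λ (i : Fin n) → sumE (λ (k : Fin p) → x i • mulζ^ (toℕ i) (ζ^ (toℕ k))))
    ≈⟨ sumE-cong (λ (i : Fin n) → ≈E-trans (sumE-• (x i) (λ (k : Fin p) → mulζ^ (toℕ i) (ζ^ (toℕ k))))
         (•-congʳ (x i) (mulζ^-sum-ζ^ (toℕ i)))) ⟩
      sumE (λ (i : Fin n) → x i • zeroE)
    ≈⟨ sumE-zero (λ (i : Fin n) → x i • zeroE) (λ i j → ℤP.*-zeroʳ (x i)) ⟩
      zeroE
    ∎
    where
    open ≈E-Reasoning
    mulζ^-sum-ζ^ : ∀ i → sumE {m = p} (λ k → mulζ^ i (ζ^ (toℕ k))) ≈E zeroE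
    mulζ^-sum-ζ^ i = ≈E-trans (≈E-sym (mulζ^.hom-sum i {p} (ζ^ ∘ toℕ)))
      (≈E-trans (mulζ^.cong-≈ i sum-ζ^) (mulζ^.hom-zero i))

  sum-mulζ^-at : ∀ x j → sumBelow p (λ k → mulζ^ k x j) ≡ 0ℤ
  sum-mulζ^-at x j = trans (sym (sumE-at {m = p} (λ k → mulζ^ (toℕ k) x) j)) (sum-mulζ^ x j)

  -- mulζ is adjoint to the shift G ↦ G ∘ suc on sequences summing to 0 over a period.
  sumℤ-mulζ-shift : (G : ℕ → ℤ) → sumBelow p G ≡ 0ℤ → (w : Elem n) →
    sumℤ (λ i → mulζ w i * G (toℕ i)) ≡ sumℤ (λ i → w i * G (suc (toℕ i)))
  sumℤ-mulζ-shift G ΣG≡0 w = begin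
      sumℤ (λ i → mulζ w i * G (toℕ i))
    ≡⟨⟩
      - w top * G 0 + sumℤ {m} (λ j → (w (inject₁ j) - w top) * G (suc (toℕ j)))
    ≡⟨ cong (λ t → - w top * G 0 + t) split ⟩
      - w top * G 0 + (A + - w top * B)
    ≡⟨ regroup (w top) (G 0) A B (G n) ⟩
      (A + w top * G n) + - w top * (G 0 + (B + G n))
    ≡⟨ cong (λ t → (A + w top * G n) + - w top * t) relation ⟩
      (A + w top * G n) + - w top * 0ℤ
    ≡⟨ cong (λ t → (A + w top * G n) + t) (ℤP.*-zeroʳ (- w top)) ⟩
      (A + w top * G n) + 0ℤ
    ≡⟨ ℤP.+-identityʳ _ ⟩
      A + w top * G n
    ≡⟨ init-last ⟨
      sumℤ (λ i → w i * G (suc (toℕ i)))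
    ∎
    where
    open ≡-Reasoning
    A B : ℤ
    A = sumℤ {m} (λ j → w (inject₁ j) * G (suc (toℕ j)))
    B = sumBelow m (G ∘ suc)
    regroup : ∀ w g₀ A B gₙ → - w * g₀ + (A + - w * B) ≡ (A + w * gₙ) + - w * (g₀ + (B + gₙ))
    regroup = solve-∀
    distrib : ∀ a c g → (a - c) * g ≡ a * g + - c * g
    distrib = solve-∀
    split : sumℤ {m} (λ j → (w (inject₁ j) - w top) * G (suc (toℕ j))) ≡ A + - w top * B
    split = trans (sumℤ-cong {m} (λ j → distrib (w (inject₁ j)) (w top) (G (suc (toℕ j)))))
      (trans (sumℤ-distrib-+ {m} (λ j → w (inject₁ j) * G (suc (toℕ j))) (λ j → - w top * G (suc (toℕ j))))
        (cong (λ t → A + t) (sumℤ-*ˡ {m} (- w top) (G ∘ suc ∘ toℕ))))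
    relation : G 0 + (B + G n) ≡ 0ℤ
    relation = trans (cong (λ t → G 0 + t) (sym (sumBelow-suc m (G ∘ suc)))) ΣG≡0
    init-last : sumℤ (λ i → w i * G (suc (toℕ i))) ≡ A + w top * G n
    init-last = trans (sumℤ-init-last (λ i → w i * G (suc (toℕ i))))
      (cong₂ _+_ (sumℤ-cong (λ j → cong (λ t → w (inject₁ j) * G (suc t)) (FinP.toℕ-inject₁ j)))
                 (cong (λ t → w top * G (suc t)) (FinP.toℕ-fromℕ m)))

  mul-mulζ : ∀ x w → mul x (mulζ w) ≈E mulζ (mul x w)
  mul-mulζ x w j = begin
    mul x (mulζ w) j                                ≡⟨ sumE-at (λ i → mulζ w i • mulζ^ (toℕ i) x) j ⟩
    sumℤ (λ i → mulζ w i * mulζ^ (toℕ i) x j)       ≡⟨ sumℤ-mulζ-shift (λ k → mulζ^ k x j) (sum-mulζ^-at x j) w ⟩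
    sumℤ (λ i → w i * mulζ (mulζ^ (toℕ i) x) j)     ≡⟨ sumE-at (λ i → w i • mulζ (mulζ^ (toℕ i) x)) j ⟨
    sumE (λ i → w i • mulζ (mulζ^ (toℕ i) x)) j     ≡⟨ mulζ.hom-comb w (λ i → mulζ^ (toℕ i) x) j ⟨
    mulζ (mul x w) j                                ∎
    where open ≡-Reasoning

  mul-mulζ^ : ∀ k x w → mul x (mulζ^ k w) ≈E mulζ^ k (mul x w)
  mul-mulζ^ zero x w = ≈E-refl
  mul-mulζ^ (suc k) x w = ≈E-trans (mul-mulζ x (mulζ^ k w)) (mulζ.cong-≈ (mul-mulζ^ k x w))

  mul-basis : ∀ x (i : Fin n) → mul x (basis i) ≈E mulζ^ (toℕ i) x
  mul-basis x i j = trans (sumE-at (λ l → basis i l • mulζ^ (toℕ l) x) j) (sumℤ-basis-* i (λ l → mulζ^ (toℕ l) x j))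

  mul-identityʳ : ∀ x → mul x oneE ≈E x
  mul-identityʳ x = mul-basis x zero

  mul-ζ^ : ∀ x k → mul x (ζ^ k) ≈E mulζ^ k x
  mul-ζ^ x k = ≈E-trans (mul-mulζ^ k x oneE) (mulζ^.cong-≈ k (mul-identityʳ x))

  mul-linearʳ : ∀ a → IsLinear (mul a)
  mul-linearʳ a = record
    { cong-≈ = λ b≈b' → sumE-cong (λ i → λ j → cong (_* mulζ^ (toℕ i) a j) (b≈b' i))
    ; hom-⊕ = λ b c → ≈E-trans (sumE-cong (λ i → •-distribʳ-+ (b i) (c i) (mulζ^ (toℕ i) a)))
                               (sumE-distrib-⊕ (λ i → b i • mulζ^ (toℕ i) a) (λ i → c i • mulζ^ (toℕ i) a))
    ; hom-• = λ c b → ≈E-trans (sumE-cong (λ i → ≈E-sym (•-assoc c (b i) (mulζ^ (toℕ i) a))))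
                               (sumE-• c (λ i → b i • mulζ^ (toℕ i) a))
    }

  mul-linearˡ : ∀ b → IsLinear (λ a → mul a b)
  mul-linearˡ b = record
    { cong-≈ = λ a≈a' → sumE-cong (λ i → •-congʳ (b i) (mulζ^.cong-≈ (toℕ i) a≈a'))
    ; hom-⊕ = λ a a' → ≈E-trans
        (sumE-cong (λ i → ≈E-trans (•-congʳ (b i) (mulζ^.hom-⊕ (toℕ i) a a'))
                                   (•-distribˡ-⊕ (b i) (mulζ^ (toℕ i) a) (mulζ^ (toℕ i) a'))))
        (sumE-distrib-⊕ (λ i → b i • mulζ^ (toℕ i) a) (λ i → b i • mulζ^ (toℕ i) a'))
    ; hom-• = λ c a → ≈E-trans
        (sumE-cong (λ i → ≈E-trans (•-congʳ (b i) (mulζ^.hom-• (toℕ i) c a)) (•-comm (b i) c (mulζ^ (toℕ i) a))))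
        (sumE-• c (λ i → b i • mulζ^ (toℕ i) a))
    }

  mul-cong : ∀ {a a' b b'} → a ≈E a' → b ≈E b' → mul a b ≈E mul a' b'
  mul-cong {a} {a'} {b} {b'} a≈a' b≈b' = ≈E-trans (IsLinear.cong-≈ (mul-linearˡ b) a≈a') (IsLinear.cong-≈ (mul-linearʳ a') b≈b')

  mul-congˡ : ∀ a {b b'} → b ≈E b' → mul a b ≈E mul a b'
  mul-congˡ a = IsLinear.cong-≈ (mul-linearʳ a)

  mul-congʳ : ∀ b {a a'} → a ≈E a' → mul a b ≈E mul a' b
  mul-congʳ b = IsLinear.cong-≈ (mul-linearˡ b)

  mul-assoc : ∀ x y z → mul (mul x y) z ≈E mul x (mul y z)
  mul-assoc x y z = ≈E-sym (≈E-trans (IsLinear.hom-comb (mul-linearʳ x) z (λ k → mulζ^ (toℕ k) y))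
    (sumE-cong (λ k → •-congʳ (z k) (mul-mulζ^ (toℕ k) x y))))

  ζ^-mul : ∀ i x → mul (ζ^ i) x ≈E mulζ^ i x
  ζ^-mul i x = begin
    mul (ζ^ i) x                                        ≈⟨ sumE-cong (λ j → •-congʳ (x j) (≡⇒≈E (iter-comm (toℕ j) i mulζ oneE))) ⟩
    sumE (λ j → x j • mulζ^ i (ζ^ (toℕ j)))             ≈⟨ mulζ^.hom-comb i x (ζ^ ∘ toℕ) ⟨
    mulζ^ i (sumE (λ j → x j • ζ^ (toℕ j)))             ≈⟨ mulζ^.cong-≈ i (expansion x) ⟨
    mulζ^ i x                                           ∎
    where open ≈E-Reasoning

  mul-comm : ∀ x y → mul x y ≈E mul y x
  mul-comm x y = begin
    mul x y                                   ≈⟨ sumE-cong (λ i → •-congʳ (y i) (ζ^-mul (toℕ i) x)) ⟨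
    sumE (λ i → y i • mul (ζ^ (toℕ i)) x)     ≈⟨ IsLinear.hom-comb (mul-linearˡ x) y (ζ^ ∘ toℕ) ⟨
    mul (sumE (λ i → y i • ζ^ (toℕ i))) x     ≈⟨ IsLinear.cong-≈ (mul-linearˡ x) (expansion y) ⟨
    mul y x                                   ∎
    where open ≈E-Reasoning

  mul-identityˡ : ∀ x → mul oneE x ≈E x
  mul-identityˡ x = ≈E-trans (mul-comm oneE x) (mul-identityʳ x)

  mulζ^n : ∀ x → mulζ^ n x ≈E (-1ℤ • sumE {m = n} (λ i → mulζ^ (toℕ i) x))
  mulζ^n x j = trans
    (x+y≡0⇒y≡-1*x (sumBelow n (λ k → mulζ^ k x j)) (mulζ^ n x j)
      (trans (sym (sumBelow-suc n (λ k → mulζ^ k x j))) (sum-mulζ^-at x j)))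
    (cong (-1ℤ *_) (sym (sumE-at {m = n} (λ i → mulζ^ (toℕ i) x) j)))

  mulζ^p : ∀ x → mulζ^ p x ≈E x
  mulζ^p x = begin
    mulζ (mulζ^ n x)                                   ≈⟨ mulζ.cong-≈ (mulζ^n x) ⟩
    mulζ (-1ℤ • sumE powers)                                ≈⟨ mulζ.hom-• -1ℤ (sumE powers) ⟩
    -1ℤ • mulζ (sumE powers)                                ≈⟨ •-congʳ -1ℤ (mulζ.hom-sum powers) ⟩
    -1ℤ • sumE (mulζ ∘ powers)                              ≈⟨ (λ j → cong (-1ℤ *_) (x+y≡0⇒y≡-1*x (x j) (sumE (mulζ ∘ powers) j) (sum-mulζ^ x j))) ⟩
    -1ℤ • (-1ℤ • x)                                    ≈⟨ (λ j → ℤP.-1*i≡-i (-1ℤ * x j)) ⟩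
    (λ j → - (-1ℤ * x j))                              ≈⟨ (λ j → cong -_ (ℤP.-1*i≡-i (x j))) ⟩
    (λ j → - - x j)                                    ≈⟨ (λ j → ℤP.neg-involutive (x j)) ⟩
    x                                                  ∎
    where
    open ≈E-Reasoning
    powers : Fin n → Elem n
    powers i = mulζ^ (toℕ i) x

  mulζ^-multiple-p : ∀ b x → mulζ^ (b ℕ.* p) x ≈E x
  mulζ^-multiple-p zero x = ≈E-refl
  mulζ^-multiple-p (suc b) x = ≈E-trans (≡⇒≈E (iter-+ p (b ℕ.* p) mulζ x))
    (≈E-trans (mulζ^.cong-≈ p (mulζ^-multiple-p b x)) (mulζ^p x))

  mulζ^-period : ∀ a b x → mulζ^ (a ℕ.+ b ℕ.* p) x ≈E mulζ^ a x
  mulζ^-period a b x = ≈E-trans (≡⇒≈E (iter-+ a (b ℕ.* p) mulζ x)) (mulζ^.cong-≈ a (mulζ^-multiple-p b x))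

  ζ^-mod : ∀ k → ζ^ k ≈E ζ^ (k % p)
  ζ^-mod k = ≈E-trans (mulζ^-≡ oneE (m≡m%n+[m/n]*n k p)) (mulζ^-period (k % p) (k / p) oneE)

  -- Complex conjugation

  conj-linear : IsLinear (conj {n})
  conj-linear = record
    { cong-≈ = λ a≈b → sumE-cong (λ i j → cong (_* ζ^ (n ℕ.* toℕ i) j) (a≈b i))
    ; hom-⊕ = λ a b → ≈E-trans (sumE-cong (λ i → •-distribʳ-+ (a i) (b i) (ζ^ (n ℕ.* toℕ i))))
                        (sumE-distrib-⊕ (λ i → a i • ζ^ (n ℕ.* toℕ i)) (λ i → b i • ζ^ (n ℕ.* toℕ i)))
    ; hom-• = λ c a → ≈E-trans (sumE-cong (λ i → ≈E-sym (•-assoc c (a i) (ζ^ (n ℕ.* toℕ i)))))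
                        (sumE-• c (λ i → a i • ζ^ (n ℕ.* toℕ i)))
    }

  module conj = IsLinear conj-linear

  n*[1+k]≡n∸k+k*p : ∀ k → k ℕ.≤ n → n ℕ.* suc k ≡ (n ℕ.∸ k) ℕ.+ k ℕ.* p
  n*[1+k]≡n∸k+k*p k k≤n = begin
    n ℕ.* suc k                              ≡⟨ cong (ℕ._* suc k) (ℕP.m∸n+n≡m k≤n) ⟨
    (n ℕ.∸ k ℕ.+ k) ℕ.* suc k                ≡⟨ identity (n ℕ.∸ k) k ⟩
    n ℕ.∸ k ℕ.+ k ℕ.* suc (n ℕ.∸ k ℕ.+ k)    ≡⟨ cong (λ t → n ℕ.∸ k ℕ.+ k ℕ.* suc t) (ℕP.m∸n+n≡m k≤n) ⟩
    n ℕ.∸ k ℕ.+ k ℕ.* p                      ∎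
    where
    open ≡-Reasoning
    identity : ∀ d k → (d ℕ.+ k) ℕ.* suc k ≡ d ℕ.+ k ℕ.* suc (d ℕ.+ k)
    identity = ℕ-Solver.solve-∀

  -- ζ^(n k) = ζ^(-k), so the terms are again 1, ζ, …, ζ^n in reverse order.
  sum-ζ^[n*k] : sumE {m = p} (λ k → ζ^ (n ℕ.* toℕ k)) ≈E zeroE
  sum-ζ^[n*k] j = begin
      sumE {m = p} (λ k → ζ^ (n ℕ.* toℕ k)) j
    ≡⟨ sumE-at {m = p} (λ k → ζ^ (n ℕ.* toℕ k)) j ⟩
      G (n ℕ.* 0) + sumBelow n (λ k → G (n ℕ.* suc k))
    ≡⟨ cong₂ _+_ (cong G (ℕP.*-zeroʳ n)) reindex ⟩
      sumBelow p G
    ≡⟨ sum-mulζ^-at oneE j ⟩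
      0ℤ
    ∎
    where
    open ≡-Reasoning
    G : ℕ → ℤ
    G k = ζ^ k j
    reindex : sumBelow n (λ k → G (n ℕ.* suc k)) ≡ sumBelow n (G ∘ suc)
    reindex = begin
      sumBelow n (λ k → G (n ℕ.* suc k))          ≡⟨ sumBelow-cong n (λ k k<n → mulζ^-≡ oneE (n*[1+k]≡n∸k+k*p k (ℕP.<⇒≤ k<n)) j) ⟩
      sumBelow n (λ k → G (n ℕ.∸ k ℕ.+ k ℕ.* p))  ≡⟨ sumBelow-cong n (λ k _ → mulζ^-period (n ℕ.∸ k) k oneE j) ⟩
      sumBelow n (λ k → G (n ℕ.∸ k))              ≡⟨ sumBelow-cong n (λ k k<n → cong G (ℕP.+-∸-assoc 1 k<n)) ⟩
      sumBelow n (λ k → G (suc (n ℕ.∸ suc k)))    ≡⟨ sumBelow-reverse n (G ∘ suc) ⟨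
      sumBelow n (G ∘ suc)                        ∎

  conj-mulζ : ∀ w → conj (mulζ w) ≈E mulζ^ n (conj w)
  conj-mulζ w j = begin
      conj (mulζ w) j
    ≡⟨ sumE-at (λ i → mulζ w i • ζ^ (n ℕ.* toℕ i)) j ⟩
      sumℤ (λ i → mulζ w i * ζ^ (n ℕ.* toℕ i) j)
    ≡⟨ sumℤ-mulζ-shift (λ k → ζ^ (n ℕ.* k) j) (trans (sym (sumE-at {m = p} (λ k → ζ^ (n ℕ.* toℕ k)) j)) (sum-ζ^[n*k] j)) w ⟩
      sumℤ (λ i → w i * ζ^ (n ℕ.* suc (toℕ i)) j)
    ≡⟨ sumℤ-cong (λ i → cong (w i *_) (trans (mulζ^-≡ oneE (ℕP.*-suc n (toℕ i)) j) (cong (_$ j) (iter-+ n (n ℕ.* toℕ i) mulζ oneE)))) ⟩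
      sumℤ (λ i → w i * mulζ^ n (ζ^ (n ℕ.* toℕ i)) j)
    ≡⟨ sumE-at (λ i → w i • mulζ^ n (ζ^ (n ℕ.* toℕ i))) j ⟨
      sumE (λ i → w i • mulζ^ n (ζ^ (n ℕ.* toℕ i))) j
    ≡⟨ mulζ^.hom-comb n w (λ i → ζ^ (n ℕ.* toℕ i)) j ⟨
      mulζ^ n (conj w) j
    ∎
    where open ≡-Reasoning

  conj-mulζ^ : ∀ k w → conj (mulζ^ k w) ≈E mulζ^ (n ℕ.* k) (conj w)
  conj-mulζ^ zero w = mulζ^-≡ (conj w) (sym (ℕP.*-zeroʳ n))
  conj-mulζ^ (suc k) w = begin
    conj (mulζ (mulζ^ k w))              ≈⟨ conj-mulζ (mulζ^ k w) ⟩
    mulζ^ n (conj (mulζ^ k w))           ≈⟨ mulζ^.cong-≈ n (conj-mulζ^ k w) ⟩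
    mulζ^ n (mulζ^ (n ℕ.* k) (conj w))   ≈⟨ ≡⇒≈E (iter-+ n (n ℕ.* k) mulζ (conj w)) ⟨
    mulζ^ (n ℕ.+ n ℕ.* k) (conj w)       ≈⟨ mulζ^-≡ (conj w) (ℕP.*-suc n k) ⟨
    mulζ^ (n ℕ.* suc k) (conj w)         ∎
    where open ≈E-Reasoning

  conj-mul : ∀ x y → conj (mul x y) ≈E mul (conj x) (conj y)
  conj-mul x y = begin
    conj (mul x y)                                         ≈⟨ conj.hom-comb y (λ i → mulζ^ (toℕ i) x) ⟩
    sumE (λ i → y i • conj (mulζ^ (toℕ i) x))              ≈⟨ sumE-cong (λ i → •-congʳ (y i) (conj-mulζ^ (toℕ i) x)) ⟩
    sumE (λ i → y i • mulζ^ (n ℕ.* toℕ i) (conj x))        ≈⟨ sumE-cong (λ i → •-congʳ (y i) (mul-ζ^ (conj x) (n ℕ.* toℕ i))) ⟨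
    sumE (λ i → y i • mul (conj x) (ζ^ (n ℕ.* toℕ i)))     ≈⟨ IsLinear.hom-comb (mul-linearʳ (conj x)) y (λ i → ζ^ (n ℕ.* toℕ i)) ⟨
    mul (conj x) (conj y)                                  ∎
    where open ≈E-Reasoning

  conj-one : conj oneE ≈E oneE
  conj-one = ≈E-trans (sumE-basis-• {m = n} zero (λ i → ζ^ (n ℕ.* toℕ i))) (mulζ^-≡ oneE (ℕP.*-zeroʳ n))

  conj-ζ^ : ∀ k → conj (ζ^ k) ≈E ζ^ (n ℕ.* k)
  conj-ζ^ k = ≈E-trans (conj-mulζ^ k oneE) (mulζ^.cong-≈ (n ℕ.* k) conj-one)

  conj-involutive : ∀ x → conj (conj x) ≈E x
  conj-involutive x = begin
    conj (conj x)                                  ≈⟨ conj.hom-comb x (λ i → ζ^ (n ℕ.* toℕ i)) ⟩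
    sumE (λ i → x i • conj (ζ^ (n ℕ.* toℕ i)))     ≈⟨ sumE-cong (λ i → •-congʳ (x i) (conj-ζ^[n*i] (toℕ i))) ⟩
    sumE (λ i → x i • ζ^ (toℕ i))                  ≈⟨ expansion x ⟨
    x                                              ∎
    where
    open ≈E-Reasoning
    n*[n*i]≡i+m*i*p : ∀ m i → suc m ℕ.* (suc m ℕ.* i) ≡ i ℕ.+ (m ℕ.* i) ℕ.* suc (suc m)
    n*[n*i]≡i+m*i*p = ℕ-Solver.solve-∀
    conj-ζ^[n*i] : ∀ i → conj (ζ^ (n ℕ.* i)) ≈E ζ^ i
    conj-ζ^[n*i] i = ≈E-trans (conj-ζ^ (n ℕ.* i))
      (≈E-trans (mulζ^-≡ oneE (n*[n*i]≡i+m*i*p m i)) (mulζ^-period i (m ℕ.* i) oneE))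

  powE : Elem n → ℕ → Elem n
  powE a zero = oneE
  powE a (suc k) = mul a (powE a k)

  pow-cong : ∀ {a b} k → a ≈E b → powE a k ≈E powE b k
  pow-cong zero a≈b = ≈E-refl
  pow-cong (suc k) a≈b = mul-cong a≈b (pow-cong k a≈b)

  mul-interchange : ∀ a b c d → mul (mul a b) (mul c d) ≈E mul (mul a c) (mul b d)
  mul-interchange a b c d = begin
    mul (mul a b) (mul c d)   ≈⟨ mul-assoc a b (mul c d) ⟩
    mul a (mul b (mul c d))   ≈⟨ mul-congˡ a (mul-assoc b c d) ⟨
    mul a (mul (mul b c) d)   ≈⟨ mul-congˡ a (mul-congʳ d (mul-comm b c)) ⟩
    mul a (mul (mul c b) d)   ≈⟨ mul-congˡ a (mul-assoc c b d) ⟩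
    mul a (mul c (mul b d))   ≈⟨ mul-assoc a c (mul b d) ⟨
    mul (mul a c) (mul b d)   ∎
    where open ≈E-Reasoning

  pow-mul : ∀ a b k → powE (mul a b) k ≈E mul (powE a k) (powE b k)
  pow-mul a b zero = ≈E-sym (mul-identityʳ oneE)
  pow-mul a b (suc k) = ≈E-trans (mul-congˡ (mul a b) (pow-mul a b k)) (mul-interchange a b (powE a k) (powE b k))

  pow-one : ∀ k → powE oneE k ≈E oneE
  pow-one zero = ≈E-refl
  pow-one (suc k) = ≈E-trans (mul-identityˡ (powE oneE k)) (pow-one k)

  conj-pow : ∀ a k → conj (powE a k) ≈E powE (conj a) k
  conj-pow a zero = conj-one
  conj-pow a (suc k) = ≈E-trans (conj-mul a (powE a k)) (mul-congˡ (conj a) (conj-pow a k))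

  mul-•-• : ∀ c d a b → mul (c • a) (d • b) ≈E ((c * d) • mul a b)
  mul-•-• c d a b = ≈E-trans (IsLinear.hom-• (mul-linearˡ (d • b)) c a)
    (≈E-trans (•-congʳ c (IsLinear.hom-• (mul-linearʳ a) d b)) (•-assoc c d (mul a b)))

  pow-• : ∀ c a k → powE (c • a) k ≈E ((c ℤ.^ k) • powE a k)
  pow-• c a zero j = sym (ℤP.*-identityˡ (oneE j))
  pow-• c a (suc k) = ≈E-trans (mul-congˡ (c • a) (pow-• c a k)) (mul-•-• c (c ℤ.^ k) a (powE a k))

  pow-ζ^ : ∀ r k → powE (ζ^ r) k ≈E ζ^ (r ℕ.* k)
  pow-ζ^ r zero = mulζ^-≡ oneE (sym (ℕP.*-zeroʳ r))
  pow-ζ^ r (suc k) = begin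
    mul (ζ^ r) (powE (ζ^ r) k)    ≈⟨ mul-congˡ (ζ^ r) (pow-ζ^ r k) ⟩
    mul (ζ^ r) (ζ^ (r ℕ.* k))     ≈⟨ ζ^-mul r (ζ^ (r ℕ.* k)) ⟩
    mulζ^ r (ζ^ (r ℕ.* k))        ≈⟨ ≡⇒≈E (iter-+ r (r ℕ.* k) mulζ oneE) ⟨
    ζ^ (r ℕ.+ r ℕ.* k)            ≈⟨ mulζ^-≡ oneE (ℕP.*-suc r k) ⟨
    ζ^ (r ℕ.* suc k)              ∎
    where open ≈E-Reasoning

  -- Tr ζ^i is n for i ≡ 0 and -1 for 0 < i < p, hence Tr (Σ yᵢ ζ^i) = p y₀ - Σ yᵢ.
  trace : Elem n → ℤ
  trace y = + p * y zero - sumℤ y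

  trace-cong : ∀ {a b} → a ≈E b → trace a ≡ trace b
  trace-cong a≈b = cong₂ _-_ (cong (+ p *_) (a≈b zero)) (sumℤ-cong a≈b)

  trace-comb : ∀ {k} (c : Fin k → ℤ) (f : Fin k → Elem n) →
               trace (sumE (λ i → c i • f i)) ≡ sumℤ (λ i → c i * trace (f i))
  trace-comb c f = begin
      + p * sumE (λ i → c i • f i) zero - sumℤ (sumE (λ i → c i • f i))
    ≡⟨ cong₂ _-_ (cong (+ p *_) (sumE-at (λ i → c i • f i) zero)) (sumℤ-sumE c f) ⟩
      + p * sumℤ (λ i → c i * f i zero) - sumℤ (λ i → c i * sumℤ (f i))
    ≡⟨ cong₂ _+_ (sumℤ-*ˡ (+ p) (λ i → c i * f i zero)) (sumℤ-neg (λ i → c i * sumℤ (f i))) ⟨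
      sumℤ (λ i → + p * (c i * f i zero)) + sumℤ (λ i → - (c i * sumℤ (f i)))
    ≡⟨ sumℤ-distrib-+ (λ i → + p * (c i * f i zero)) (λ i → - (c i * sumℤ (f i))) ⟨
      sumℤ (λ i → + p * (c i * f i zero) + - (c i * sumℤ (f i)))
    ≡⟨ sumℤ-cong (λ i → factor (+ p) (c i) (f i zero) (sumℤ (f i))) ⟩
      sumℤ (λ i → c i * trace (f i))
    ∎
    where
    open ≡-Reasoning
    factor : ∀ P c a s → P * (c * a) + - (c * s) ≡ c * (P * a - s)
    factor = solve-∀

  trace-basis : ∀ (i : Fin n) → trace (basis i) ≡ + p * basis i zero - 1ℤ
  trace-basis i = cong (λ t → + p * basis i zero - t) (sumℤ-basis i)

  trace-diagonal : ∀ (i : Fin n) → + p * basis i i - 1ℤ ≡ + n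
  trace-diagonal i = trans (cong (λ t → + p * t - 1ℤ) (basis-diag i)) (simplify (+ n))
    where
    simplify : ∀ N → (+ 1 + N) * 1ℤ - 1ℤ ≡ N
    simplify = solve-∀

  trace-one : trace oneE ≡ + n
  trace-one = trans (trace-basis zero) (trace-diagonal zero)

  trace-minusOnes : trace minusOnes ≡ -1ℤ
  trace-minusOnes = trans (cong (λ t → + p * -1ℤ - t) (sumℤ-const n -1ℤ)) (simplify (+ n))
    where
    simplify : ∀ N → (+ 1 + N) * -1ℤ - N * -1ℤ ≡ -1ℤ
    simplify = solve-∀

  trace-off-diagonal : ∀ {i j : Fin n} → i ≢ j → + p * basis i j - 1ℤ ≡ -1ℤ
  trace-off-diagonal i≢j = trans (cong (λ t → + p * t - 1ℤ) (basis-≢ i≢j)) (cong (_- 1ℤ) (ℤP.*-zeroʳ (+ p)))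

  trace-ζ^ : ∀ r → 0 ℕ.< r → r ℕ.< p → trace (ζ^ r) ≡ -1ℤ
  trace-ζ^ r 0<r (s≤s r≤n) with ℕP.m≤n⇒m<n∨m≡n r≤n
  ... | inj₂ refl = trans (trace-cong ζ^n) trace-minusOnes
  ... | inj₁ r<n = trans (trace-cong (ζ^-basis r i (FinP.toℕ-fromℕ< r<n)))
                        (trans (trace-basis i) (trace-off-diagonal i≢0))
    where
    i : Fin n
    i = Fin.fromℕ< r<n
    i≢0 : i ≢ zero
    i≢0 i≡0 = ℕP.<⇒≢ 0<r (sym (trans (sym (FinP.toℕ-fromℕ< r<n)) (cong toℕ i≡0)))

  trace-ζ^-shifted : ∀ k r q → k ≡ r ℕ.+ q ℕ.* p → 0 ℕ.< r → r ℕ.< p → trace (ζ^ k) ≡ -1ℤ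
  trace-ζ^-shifted k r q k≡r+qp 0<r r<p =
    trans (trace-cong (≈E-trans (mulζ^-≡ oneE k≡r+qp) (mulζ^-period r q oneE))) (trace-ζ^ r 0<r r<p)

  trace-ζ^[a+n*c] : ∀ a c → a ℕ.< c → c ℕ.≤ n → trace (ζ^ (a ℕ.+ n ℕ.* c)) ≡ -1ℤ
  trace-ζ^[a+n*c] a (suc b) (s≤s a≤b) b<n = trace-ζ^-shifted _ r b a+n[1+b]≡r+bp 0<r r<p
    where
    r : ℕ
    r = a ℕ.+ (n ℕ.∸ b)
    a+n[1+b]≡r+bp : a ℕ.+ n ℕ.* suc b ≡ r ℕ.+ b ℕ.* p
    a+n[1+b]≡r+bp = trans (cong (a ℕ.+_) (n*[1+k]≡n∸k+k*p b (ℕP.<⇒≤ b<n))) (sym (ℕP.+-assoc a (n ℕ.∸ b) (b ℕ.* p)))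
    0<r : 0 ℕ.< r
    0<r = ℕP.≤-trans (ℕP.m<n⇒0<n∸m b<n) (ℕP.m≤n+m (n ℕ.∸ b) a)
    r<p : r ℕ.< p
    r<p = s≤s (ℕP.≤-trans (ℕP.+-monoˡ-≤ (n ℕ.∸ b) a≤b) (ℕP.≤-reflexive (ℕP.m+[n∸m]≡n (ℕP.<⇒≤ b<n))))

  trace-ζ^[i+n*j] : ∀ (i j : Fin n) → trace (ζ^ (toℕ i ℕ.+ n ℕ.* toℕ j)) ≡ + p * basis i j - 1ℤ
  trace-ζ^[i+n*j] i j with ℕP.<-cmp (toℕ i) (toℕ j)
  ... | tri≈ _ i≡j _ = begin
      trace (ζ^ (toℕ i ℕ.+ n ℕ.* toℕ j))     ≡⟨ trace-cong (mulζ^-≡ oneE i+nj≡jp) ⟩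
      trace (ζ^ (0 ℕ.+ toℕ j ℕ.* p))         ≡⟨ trace-cong (mulζ^-period 0 (toℕ j) oneE) ⟩
      trace oneE                            ≡⟨ trace-one ⟩
      + n                                   ≡⟨ trace-diagonal j ⟨
      + p * basis j j - 1ℤ                  ≡⟨ cong (λ t → + p * basis t j - 1ℤ) (FinP.toℕ-injective i≡j) ⟨
      + p * basis i j - 1ℤ                  ∎
    where
    open ≡-Reasoning
    i+nj≡jp : toℕ i ℕ.+ n ℕ.* toℕ j ≡ toℕ j ℕ.* p
    i+nj≡jp = trans (cong₂ ℕ._+_ i≡j (ℕP.*-comm n (toℕ j))) (sym (ℕP.*-suc (toℕ j) n))
  ... | tri> _ i≢j j<i = trans (trace-ζ^-shifted _ (toℕ i ℕ.∸ toℕ j) (toℕ j) i+nj≡ 0<i-j i-j<p)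
                               (sym (trace-off-diagonal (i≢j ∘ cong toℕ)))
    where
    regroup : ∀ d b n → (d ℕ.+ b) ℕ.+ n ℕ.* b ≡ d ℕ.+ b ℕ.* suc n
    regroup = ℕ-Solver.solve-∀
    i+nj≡ : toℕ i ℕ.+ n ℕ.* toℕ j ≡ (toℕ i ℕ.∸ toℕ j) ℕ.+ toℕ j ℕ.* p
    i+nj≡ = trans (cong (ℕ._+ n ℕ.* toℕ j) (sym (ℕP.m∸n+n≡m (ℕP.<⇒≤ j<i)))) (regroup (toℕ i ℕ.∸ toℕ j) (toℕ j) n)
    0<i-j : 0 ℕ.< toℕ i ℕ.∸ toℕ j
    0<i-j = ℕP.m<n⇒0<n∸m j<i
    i-j<p : toℕ i ℕ.∸ toℕ j ℕ.< p
    i-j<p = ℕP.≤-<-trans (ℕP.m∸n≤m (toℕ i) (toℕ j)) (ℕP.<-trans (FinP.toℕ<n i) (ℕP.n<1+n n))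
  ... | tri< i<j i≢j _ = trans (trace-ζ^[a+n*c] (toℕ i) (toℕ j) i<j (ℕP.<⇒≤ (FinP.toℕ<n j)))
                               (sym (trace-off-diagonal (i≢j ∘ cong toℕ)))

  trace-mulζ^-conj : ∀ x (i : Fin n) → trace (mulζ^ (toℕ i) (conj x)) ≡ + p * x i - sumℤ x
  trace-mulζ^-conj x i = begin
      trace (mulζ^ (toℕ i) (conj x))
    ≡⟨ trace-cong (mulζ^.hom-comb (toℕ i) x (λ j → ζ^ (n ℕ.* toℕ j))) ⟩
      trace (sumE (λ j → x j • mulζ^ (toℕ i) (ζ^ (n ℕ.* toℕ j))))
    ≡⟨ trace-comb x (λ j → mulζ^ (toℕ i) (ζ^ (n ℕ.* toℕ j))) ⟩
      sumℤ (λ j → x j * trace (mulζ^ (toℕ i) (ζ^ (n ℕ.* toℕ j))))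
    ≡⟨ sumℤ-cong (λ j → cong (x j *_) (trans (cong trace (sym (iter-+ (toℕ i) (n ℕ.* toℕ j) mulζ oneE))) (trace-ζ^[i+n*j] i j))) ⟩
      sumℤ (λ j → x j * (+ p * basis i j - 1ℤ))
    ≡⟨ sumℤ-cong (λ j → expand (x j) (+ p) (basis i j)) ⟩
      sumℤ (λ j → + p * (basis i j * x j) + - x j)
    ≡⟨ sumℤ-distrib-+ (λ j → + p * (basis i j * x j)) (λ j → - x j) ⟩
      sumℤ (λ j → + p * (basis i j * x j)) + sumℤ (λ j → - x j)
    ≡⟨ cong₂ _+_ (trans (sumℤ-*ˡ (+ p) (λ j → basis i j * x j)) (cong (+ p *_) (sumℤ-basis-* i x))) (sumℤ-neg x) ⟩
      + p * x i - sumℤ x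
    ∎
    where
    open ≡-Reasoning
    expand : ∀ x P d → x * (P * d - 1ℤ) ≡ P * (d * x) + - x
    expand = solve-∀

  trace-conj-mul : ∀ x → trace (mul (conj x) x) ≡ + p * sumSq x - sumℤ x * sumℤ x
  trace-conj-mul x = begin
      trace (mul (conj x) x)
    ≡⟨ trace-comb x (λ i → mulζ^ (toℕ i) (conj x)) ⟩
      sumℤ (λ i → x i * trace (mulζ^ (toℕ i) (conj x)))
    ≡⟨ sumℤ-cong (λ i → cong (x i *_) (trace-mulζ^-conj x i)) ⟩
      sumℤ (λ i → x i * (+ p * x i - S))
    ≡⟨ sumℤ-cong (λ i → expand (x i) (+ p) S) ⟩
      sumℤ (λ i → + p * (x i * x i) + - S * x i)
    ≡⟨ sumℤ-distrib-+ (λ i → + p * (x i * x i)) (λ i → - S * x i) ⟩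
      sumℤ (λ i → + p * (x i * x i)) + sumℤ (λ i → - S * x i)
    ≡⟨ cong₂ _+_ (sumℤ-*ˡ (+ p) (λ i → x i * x i)) (sumℤ-*ˡ (- S) x) ⟩
      + p * sumSq x + - S * S
    ≡⟨ cong (λ t → + p * sumSq x + t) (sym (ℤP.neg-distribˡ-* S S)) ⟩
      + p * sumSq x - S * S
    ∎
    where
    open ≡-Reasoning
    S : ℤ
    S = sumℤ x
    expand : ∀ x P S → x * (P * x - S) ≡ P * (x * x) + - S * x
    expand = solve-∀

  -- The coordinate sum is the reduction ζ ↦ 1, a ring homomorphism ℤ[ζ] → ℤ/p.
  sumℤ-mulζ : ∀ y → sumℤ (mulζ y) ≡ sumℤ y + - y top * + p
  sumℤ-mulζ y = begin
      - y top + sumℤ {m} (λ j → y (inject₁ j) - y top)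
    ≡⟨ cong (λ t → - y top + t) (trans (sumℤ-distrib-+ {m} (y ∘ inject₁) (λ _ → - y top)) (cong (λ t → A + t) (sumℤ-const m (- y top)))) ⟩
      - y top + (A + + m * - y top)
    ≡⟨ regroup (y top) A (+ m) ⟩
      (A + y top) + - y top * (+ 1 + (+ 1 + + m))
    ≡⟨ cong₂ (λ s t → s + - y top * t) (sym (sumℤ-init-last y)) (sym (trans (ℤP.pos-+ 1 (suc m)) (cong (λ t → + 1 + t) (ℤP.pos-+ 1 m)))) ⟩
      sumℤ y + - y top * + p
    ∎
    where
    open ≡-Reasoning
    A : ℤ
    A = sumℤ {m} (y ∘ inject₁)
    regroup : ∀ t A M → - t + (A + M * - t) ≡ (A + t) + - t * (+ 1 + (+ 1 + M))
    regroup = solve-∀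

  sumℤ-mulζ^ : ∀ k y → sumℤ (mulζ^ k y) ≡ sumℤ y mod + p
  sumℤ-mulζ^ zero y = ≡-mod-refl
  sumℤ-mulζ^ (suc k) y = ≡-mod-trans (≡-mod (- mulζ^ k y top) (sumℤ-mulζ (mulζ^ k y))) (sumℤ-mulζ^ k y)

  sumℤ-mul : ∀ x y → sumℤ (mul x y) ≡ sumℤ x * sumℤ y mod + p
  sumℤ-mul x y = ≡-mod-trans (≡⇒≡-mod (sumℤ-sumE y (λ i → mulζ^ (toℕ i) x)))
    (≡-mod-trans (sumℤ-cong-mod (λ i → *-cong-mod (≡-mod-refl {y i}) (sumℤ-mulζ^ (toℕ i) x)))
      (≡⇒≡-mod (trans (sumℤ-cong (λ i → ℤP.*-comm (y i) (sumℤ x))) (sumℤ-*ˡ (sumℤ x) y))))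

  sumℤ-conj : ∀ y → sumℤ (conj y) ≡ sumℤ y mod + p
  sumℤ-conj y = ≡-mod-trans (≡⇒≡-mod (sumℤ-sumE {n} {n} y (λ i → ζ^ (n ℕ.* toℕ i))))
    (≡-mod-trans (sumℤ-cong-mod (λ i → *-cong-mod (≡-mod-refl {y i}) (≡-mod-trans (sumℤ-mulζ^ (n ℕ.* toℕ i) oneE) (≡⇒≡-mod (sumℤ-basis {n} zero)))))
      (≡⇒≡-mod (sumℤ-cong (λ i → ℤP.*-identityʳ (y i)))))

  -- Units of norm one

  record IsRootOfUnity (x : Elem n) : Set where
    constructor ±ζ^
    field
      exponent : ℕ
      exponent≤n : exponent ℕ.≤ n
      sign : ℤ
      ∣sign∣≡1 : ∣ sign ∣ ≡ 1
      x≈sign•ζ^exponent : x ≈E (sign • ζ^ exponent)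

  sumSq≡1⇒root : ∀ x → sumℕ (sqℕ ∘ x) ≡ 1 → IsRootOfUnity x
  sumSq≡1⇒root x Q≡1 with sumℕ≡1⇒single (sqℕ ∘ x) Q≡1
  ... | c , sq[xc]≡1 , others≡0 = ±ζ^ (toℕ c) (ℕP.<⇒≤ (FinP.toℕ<n c)) (x c) (ℕP.m*n≡1⇒m≡1 _ _ sq[xc]≡1) x≈
    where
    x≈ : x ≈E (x c • ζ^ (toℕ c))
    x≈ i = case i FinP.≟ c of λ where
      (yes refl) → trans (sym (ℤP.*-identityʳ (x i))) (cong (x i *_) (sym (trans (ζ^-toℕ i i) (basis-diag i))))
      (no i≢c) → trans (sqℕ≡0⇒≡0 (x i) (others≡0 i i≢c))
        (sym (trans (cong (x c *_) (trans (ζ^-toℕ c i) (basis-≢ (i≢c ∘ sym)))) (ℤP.*-zeroʳ (x c))))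

  constant⇒root : ∀ x ε → ε * ε ≡ 1ℤ → sumℤ x ≡ ε * + n → sumSq x ≡ + n → IsRootOfUnity x
  constant⇒root x ε ε²≡1 S≡εn Q≡n = ±ζ^ n ℕP.≤-refl (- ε) ∣-ε∣≡1 x≈
    where
    negate : ∀ e → e ≡ (- e) * -1ℤ
    negate = solve-∀
    x≈ : x ≈E ((- ε) • ζ^ n)
    x≈ i = trans (sumSq-all-equal x ε ε²≡1 S≡εn Q≡n i) (trans (negate ε) (cong ((- ε) *_) (sym (ζ^n i))))
    ∣-ε∣≡1 : ∣ - ε ∣ ≡ 1
    ∣-ε∣≡1 = trans (ℤP.∣-i∣≡∣i∣ ε) (ℕP.m*n≡1⇒m≡1 ∣ ε ∣ ∣ ε ∣ (trans (sym (ℤP.abs-* ε ε)) (cong ∣_∣ ε²≡1)))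

  sumSq≡n⇒root : ∀ x → sumℕ (sqℕ ∘ x) ≡ n → ∣ sumℤ x ∣ ≡ n → IsRootOfUnity x
  sumSq≡n⇒root x Q≡n = by-sign (sumℤ x) refl
    where
    sumSq≡n : sumSq x ≡ + n
    sumSq≡n = trans (sumℤ-squares x) (cong +_ Q≡n)
    by-sign : ∀ S → sumℤ x ≡ S → ∣ S ∣ ≡ n → IsRootOfUnity x
    by-sign (+ k) S≡ refl = constant⇒root x 1ℤ refl (trans S≡ (sym (ℤP.*-identityˡ (+ k)))) sumSq≡n
    by-sign -[1+ k ] S≡ refl = constant⇒root x -1ℤ refl (trans S≡ (sym (ℤP.-1*i≡-i (+ suc k)))) sumSq≡n

  norm-one⇒root-of-unity : Prime p → ∀ x → mul (conj x) x ≈E oneE → IsRootOfUnity x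
  norm-one⇒root-of-unity p-prime x x̄x≈1 =
    case p*q≡p-1+s²-solutions m Q ∣ S ∣ p-prime pQ≡n+s² (sumSq-bound x trace≡n) of λ where
      (inj₁ (Q≡1 , _)) → sumSq≡1⇒root x Q≡1
      (inj₂ (Q≡n , ∣S∣≡n)) → sumSq≡n⇒root x Q≡n ∣S∣≡n
    where
    S : ℤ
    S = sumℤ x
    Q : ℕ
    Q = sumℕ (sqℕ ∘ x)
    trace≡n : + p * sumSq x - S * S ≡ + n
    trace≡n = trans (sym (trace-conj-mul x)) (trans (trace-cong x̄x≈1) trace-one)
    pQ≡n+s² : p ℕ.* Q ≡ n ℕ.+ ∣ S ∣ ℕ.* ∣ S ∣
    pQ≡n+s² = ℤP.+-injective (begin
      + (p ℕ.* Q)              ≡⟨ ℤP.pos-* p Q ⟩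
      + p * + Q                ≡⟨ cong (+ p *_) (sumℤ-squares x) ⟨
      + p * sumSq x            ≡⟨ x-y≡z⇒x≡z+y (+ p * sumSq x) (S * S) (+ n) trace≡n ⟩
      + n + S * S              ≡⟨ cong (λ t → + n + t) (y*y≡sqℕ S) ⟩
      + n + + sqℕ S            ≡⟨ ℤP.pos-+ n (sqℕ S) ⟨
      + (n ℕ.+ sqℕ S)          ∎)
      where open ≡-Reasoning

  mul-cong-mod : ∀ {q} {a a' b b' : Elem n} → a ≈ a' mod q → b ≈ b' mod q → mul a b ≈ mul a' b' mod q
  mul-cong-mod {a' = a'} {b = b} a≈a' b≈b' =
    ≈-mod-trans (linear-cong-mod (mul-linearˡ b) a≈a') (linear-cong-mod (mul-linearʳ a') b≈b')

  matPow-mulMat : ∀ u K (j i : Fin n) → matPow (mulMat u) K j i ≡ mul (powE u K) (basis i) j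
  matPow-mulMat u zero j i = trans (basis-sym j i) (sym (trans (mul-basis oneE i j) (ζ^-toℕ i j)))
  matPow-mulMat u (suc K) j i = begin
      sumℤ (λ k → mulMat u j k * matPow (mulMat u) K k i)
    ≡⟨ sumℤ-cong (λ k → cong₂ _*_ (mul-basis u k j) (matPow-mulMat u K k i)) ⟩
      sumℤ (λ k → mulζ^ (toℕ k) u j * mul (powE u K) (basis i) k)
    ≡⟨ sumℤ-cong (λ k → ℤP.*-comm (mulζ^ (toℕ k) u j) (mul (powE u K) (basis i) k)) ⟩
      sumℤ (λ k → mul (powE u K) (basis i) k * mulζ^ (toℕ k) u j)
    ≡⟨ sumE-at (λ k → mul (powE u K) (basis i) k • mulζ^ (toℕ k) u) j ⟨
      mul u (mul (powE u K) (basis i)) j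
    ≡⟨ mul-assoc u (powE u K) (basis i) j ⟨
      mul (powE u (suc K)) (basis i) j
    ∎
    where open ≡-Reasoning

  first-column≡1-mod-gcd : ∀ (M : Mat n) x → (∀ j → M j zero ≡ x j) → x ≈ oneE mod gcdMinusI M
  first-column≡1-mod-gcd M x M₀≡x = ≈-mod-resp M₀≡x ≈E-refl (column≈basis-mod-gcd M zero)

  matPow-first-column : ∀ u K j → matPow (mulMat u) K j zero ≡ powE u K j
  matPow-first-column u K j = trans (matPow-mulMat u K j zero) (mul-identityʳ (powE u K) j)

module NonRealUnits (m : ℕ) where

  open Cyclotomic (suc m)

  conj-inverse : ∀ a b → mul a b ≈E oneE → mul (conj a) (conj b) ≈E oneE
  conj-inverse a b ab≈1 = ≈E-trans (≈E-sym (conj-mul a b)) (≈E-trans (conj.cong-≈ ab≈1) conj-one)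

  inverse-nonreal : ∀ a b → mul a b ≈E oneE → ¬ (conj a ≈E a) → ¬ (conj b ≈E b)
  inverse-nonreal a b ab≈1 a≉ā b̄≈b = a≉ā (begin
    conj a                          ≈⟨ mul-identityʳ (conj a) ⟨
    mul (conj a) oneE               ≈⟨ mul-congˡ (conj a) (≈E-trans (mul-comm b a) ab≈1) ⟨
    mul (conj a) (mul b a)          ≈⟨ mul-assoc (conj a) b a ⟨
    mul (mul (conj a) b) a          ≈⟨ mul-congʳ a (mul-congˡ (conj a) b̄≈b) ⟨
    mul (mul (conj a) (conj b)) a   ≈⟨ mul-congʳ a (conj-inverse a b ab≈1) ⟩
    mul oneE a                      ≈⟨ mul-identityˡ a ⟩
    a                               ∎)
    where open ≈E-Reasoning

  ratio-norm-one : ∀ a b → mul a b ≈E oneE → mul (conj (mul a (conj b))) (mul a (conj b)) ≈E oneE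
  ratio-norm-one a b ab≈1 = begin
    mul (conj (mul a (conj b))) (mul a (conj b))     ≈⟨ mul-congʳ (mul a (conj b)) (≈E-trans (conj-mul a (conj b)) (mul-congˡ (conj a) (conj-involutive b))) ⟩
    mul (mul (conj a) b) (mul a (conj b))            ≈⟨ mul-congʳ (mul a (conj b)) (mul-comm (conj a) b) ⟩
    mul (mul b (conj a)) (mul a (conj b))            ≈⟨ mul-interchange b (conj a) a (conj b) ⟩
    mul (mul b a) (mul (conj a) (conj b))            ≈⟨ mul-cong (≈E-trans (mul-comm b a) ab≈1) (conj-inverse a b ab≈1) ⟩
    mul oneE oneE                                    ≈⟨ mul-identityʳ oneE ⟩
    oneE                                             ∎
    where open ≈E-Reasoning

  ratio≈1⇒real : ∀ a b → mul a b ≈E oneE → mul a (conj b) ≈E oneE → conj a ≈E a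
  ratio≈1⇒real a b ab≈1 ab̄≈1 = begin
    conj a                         ≈⟨ mul-identityˡ (conj a) ⟨
    mul oneE (conj a)              ≈⟨ mul-congʳ (conj a) ab̄≈1 ⟨
    mul (mul a (conj b)) (conj a)  ≈⟨ mul-assoc a (conj b) (conj a) ⟩
    mul a (mul (conj b) (conj a))  ≈⟨ mul-congˡ a (≈E-trans (mul-comm (conj b) (conj a)) (conj-inverse a b ab≈1)) ⟩
    mul a oneE                     ≈⟨ mul-identityʳ a ⟩
    a                              ∎
    where open ≈E-Reasoning

  ratio≉-1 : ∀ a b → mul a b ≈E oneE → ¬ (mul a (conj b) ≈E (-1ℤ • oneE))
  ratio≉-1 a b ab≈1 ab̄≈-1 = ℕP.<⇒≱ (s≤s (s≤s (s≤s z≤n))) (ND.∣⇒≤ p∣2)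
    where
    S[ab̄]≡1 : sumℤ (mul a (conj b)) ≡ 1ℤ mod + p
    S[ab̄]≡1 = ≡-mod-trans (sumℤ-mul a (conj b)) (≡-mod-trans (*-cong-mod (≡-mod-refl {sumℤ a}) (sumℤ-conj b))
      (≡-mod-trans (≡-mod-sym (sumℤ-mul a b)) (≡⇒≡-mod (trans (sumℤ-cong ab≈1) (sumℤ-basis {n} zero)))))
    S[ab̄]≡-1 : sumℤ (mul a (conj b)) ≡ -1ℤ
    S[ab̄]≡-1 = trans (sumℤ-cong ab̄≈-1) (trans (sumℤ-*ˡ {n} -1ℤ oneE) (cong (-1ℤ *_) (sumℤ-basis {n} zero)))
    c : ℤ
    c = _≡_mod_.quotient S[ab̄]≡1
    cp≡-2 : c * + p ≡ -[1+ 1 ]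
    cp≡-2 = trans (isolate (c * + p)) (cong (_- 1ℤ) (sym (trans (sym S[ab̄]≡-1) (_≡_mod_.equality S[ab̄]≡1))))
      where
      isolate : ∀ x → x ≡ (1ℤ + x) - 1ℤ
      isolate = solve-∀
    p∣2 : p ND.∣ 2
    p∣2 = ND.divides ∣ c ∣ (sym (trans (sym (ℤP.abs-* c (+ p))) (cong ∣_∣ cp≡-2)))

  pow≡1-mod-inverse : ∀ {q} a b K → mul a b ≈E oneE → powE a K ≈ oneE mod q → powE b K ≈ oneE mod q
  pow≡1-mod-inverse a b K ab≈1 aᴷ≡1 = ≈-mod-trans (≈⇒≈-mod (≈E-sym (mul-identityʳ (powE b K))))
    (≈-mod-trans (mul-cong-mod {a = powE b K} {powE b K} (≈⇒≈-mod ≈E-refl) (≈-mod-sym aᴷ≡1))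
      (≈⇒≈-mod (≈E-trans (≈E-sym (pow-mul b a K)) (≈E-trans (pow-cong K (≈E-trans (mul-comm b a) ab≈1)) (pow-one K)))))

  unit-coordinate⇒q≡1 : ∀ {q} x (j : Fin n) → j ≢ zero → ∣ x j ∣ ≡ 1 → x ≈ oneE mod q → q ≡ 1
  unit-coordinate⇒q≡1 {q} x j j≢0 ∣xj∣≡1 (≈-mod c x≈1+qc) =
    ℕP.m*n≡1⇒m≡1 q ∣ c j ∣ (trans (sym (ℤP.abs-* (+ q) (c j))) (trans (cong ∣_∣ xj≡qc) ∣xj∣≡1))
    where
    xj≡qc : + q * c j ≡ x j
    xj≡qc = sym (trans (x≈1+qc j) (trans (cong (λ t → t + + q * c j) (basis-≢ (j≢0 ∘ sym))) (ℤP.+-identityˡ (+ q * c j))))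

  signed-ζ^≡1-mod⇒q≡1 : ∀ {q} ε t → ∣ ε ∣ ≡ 1 → 0 ℕ.< t → t ℕ.< p → (ε • ζ^ t) ≈ oneE mod q → q ≡ 1
  signed-ζ^≡1-mod⇒q≡1 ε t ∣ε∣≡1 0<t (s≤s t≤n) εζᵗ≡1 with ℕP.m≤n⇒m<n∨m≡n t≤n
  ... | inj₁ t<n = unit-coordinate⇒q≡1 (ε • ζ^ t) i i≢0 ∣εζᵗᵢ∣≡1 εζᵗ≡1
    where
    i : Fin n
    i = Fin.fromℕ< t<n
    i≢0 : i ≢ zero
    i≢0 i≡0 = ℕP.<⇒≢ 0<t (sym (trans (sym (FinP.toℕ-fromℕ< t<n)) (cong toℕ i≡0)))
    ∣εζᵗᵢ∣≡1 : ∣ ε * ζ^ t i ∣ ≡ 1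
    ∣εζᵗᵢ∣≡1 = trans (cong (λ z → ∣ ε * z ∣) (trans (ζ^-basis t i (FinP.toℕ-fromℕ< t<n) i) (basis-diag i)))
                     (trans (cong ∣_∣ (ℤP.*-identityʳ ε)) ∣ε∣≡1)
  ... | inj₂ refl = unit-coordinate⇒q≡1 (ε • ζ^ n) (suc zero) (λ ()) ∣εζⁿ₁∣≡1 εζᵗ≡1
    where
    ∣εζⁿ₁∣≡1 : ∣ ε * ζ^ n (suc zero) ∣ ≡ 1
    ∣εζⁿ₁∣≡1 = trans (cong (λ z → ∣ ε * z ∣) (ζ^n (suc zero))) (trans (ℤP.abs-* ε -1ℤ) (trans (ℕP.*-identityʳ ∣ ε ∣) ∣ε∣≡1))

  ratio≉±1 : ∀ a b → mul a b ≈E oneE → ¬ (conj a ≈E a) → ∀ ε → ∣ ε ∣ ≡ 1 → ¬ (mul a (conj b) ≈E (ε • ζ^ 0))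
  ratio≉±1 a b ab≈1 a≉ā ε ∣ε∣≡1 ab̄≈εζ⁰ with ∣i∣≡1⇒±1 ε ∣ε∣≡1
  ... | inj₁ refl = a≉ā (ratio≈1⇒real a b ab≈1 (≈E-trans ab̄≈εζ⁰ (λ j → ℤP.*-identityˡ (oneE j))))
  ... | inj₂ refl = ratio≉-1 a b ab≈1 ab̄≈εζ⁰

  ratio-pow≡1-mod : ∀ {q} a b K → mul a b ≈E oneE → powE a K ≈ oneE mod q →
                    powE (mul a (conj b)) K ≈ oneE mod q
  ratio-pow≡1-mod a b K ab≈1 aᴷ≡1 = ≈-mod-resp (≈E-sym (pow-mul a (conj b) K)) (mul-identityʳ oneE)
    (mul-cong-mod aᴷ≡1 (≈-mod-resp (conj-pow b K) conj-one (linear-cong-mod conj-linear (pow≡1-mod-inverse a b K ab≈1 aᴷ≡1))))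

  root-pow≡1-mod⇒q≡1 : Prime p → ∀ {q} w K (root : IsRootOfUnity w) → IsRootOfUnity.exponent root ≢ 0 →
                       ¬ (p ND.∣ K) → powE w K ≈ oneE mod q → q ≡ 1
  root-pow≡1-mod⇒q≡1 p-prime w K (±ζ^ r r≤n ε ∣ε∣≡1 w≈εζʳ) r≢0 p∤K wᴷ≡1 =
    signed-ζ^≡1-mod⇒q≡1 (ε ℤ.^ K) t (∣i^k∣≡1 K ∣ε∣≡1) (ℕP.n≢0⇒n>0 t≢0) (m%n<n (r ℕ.* K) p) (≈-mod-resp wᴷ≈ ≈E-refl wᴷ≡1)
    where
    t : ℕ
    t = (r ℕ.* K) % p
    wᴷ≈ : powE w K ≈E ((ε ℤ.^ K) • ζ^ t)
    wᴷ≈ = ≈E-trans (pow-cong K w≈εζʳ) (≈E-trans (pow-• ε (ζ^ r) K)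
      (•-congʳ (ε ℤ.^ K) (≈E-trans (pow-ζ^ r K) (ζ^-mod (r ℕ.* K)))))
    t≢0 : t ≢ 0
    t≢0 t≡0 = case euclidsLemma r K p-prime (ND.m%n≡0⇒n∣m (r ℕ.* K) p t≡0) of λ where
      (inj₁ p∣r) → r≢0 (∣∧<⇒≡0 p∣r (s≤s r≤n))
      (inj₂ p∣K) → p∤K p∣K

  pow≡1-mod⇒q≡1 : Prime p → ∀ {q} a b K → mul a b ≈E oneE → ¬ (conj a ≈E a) → ¬ (p ND.∣ K) →
                  powE a K ≈ oneE mod q → q ≡ 1
  pow≡1-mod⇒q≡1 p-prime a b K ab≈1 a≉ā p∤K aᴷ≡1 =
    case norm-one⇒root-of-unity p-prime w (ratio-norm-one a b ab≈1) of λ where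
      (±ζ^ zero _ ε ∣ε∣≡1 w≈εζ⁰) → ⊥-elim (ratio≉±1 a b ab≈1 a≉ā ε ∣ε∣≡1 w≈εζ⁰)
      root@(±ζ^ (suc r) _ _ _ _) → root-pow≡1-mod⇒q≡1 p-prime w K root (λ ()) p∤K (ratio-pow≡1-mod a b K ab≈1 aᴷ≡1)
    where
    w : Elem n
    w = mul a (conj b)

  first-column-pow-primitive : Prime p → ∀ a b → mul a b ≈E oneE → ¬ (conj a ≈E a) →
                               ∀ K → ¬ (p ND.∣ K) → (M : Mat n) → (∀ j → M j zero ≡ powE a K j) → Primitive M
  first-column-pow-primitive p-prime a b ab≈1 a≉ā K p∤K M M₀≡aᴷ =
    pow≡1-mod⇒q≡1 p-prime a b K ab≈1 a≉ā p∤K (first-column≡1-mod-gcd M (powE a K) M₀≡aᴷ)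

theorem1p3 : (p : ℕ) → Prime p → 3 < p →
    (u v : Elem (p ∸ 1)) → mul u v ≈E oneE →
    ¬ (conj u ≈E u) →
    (k : ℤ) → ¬ ((+ p) ∣ k) →
    Primitive (matZPow (mulMat u) (mulMat v) k)
theorem1p3 (suc (suc (suc (suc m)))) p-prime (s≤s (s≤s (s≤s (s≤s z≤n)))) u v uv≈1 u≉ū (+ K) p∤K =
  first-column-pow-primitive p-prime u v uv≈1 u≉ū K p∤K
    (matZPow (mulMat u) (mulMat v) (+ K)) (matPow-first-column u K)
  where
  open Cyclotomic (suc (suc m))
  open NonRealUnits (suc m)
theorem1p3 (suc (suc (suc (suc m)))) p-prime (s≤s (s≤s (s≤s (s≤s z≤n)))) u v uv≈1 u≉ū -[1+ K ] p∤1+K =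
  first-column-pow-primitive p-prime v u vu≈1 (inverse-nonreal u v uv≈1 u≉ū) (suc K) p∤1+K
    (matZPow (mulMat u) (mulMat v) -[1+ K ]) (matPow-first-column v (suc K))
  where
  open Cyclotomic (suc (suc m))
  open NonRealUnits (suc m)
  vu≈1 : mul v u ≈E oneE
  vu≈1 = ≈E-trans (mul-comm v u) uv≈1
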